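{- As formal power series in $q$, \[ \sum_{n\ge0}g_{1,1}(n)q^n=\sum_{n\ge0}\frac{nq^{n^2+n}(-q^{ -1};q^2)_n}{(q^2;q^2)_n},\qquad \sum_{n\ge0}g_{2,1}(n)q^n=\frac{1}{(q,q^5,q^6;q^8)_\infty}\cdot\frac{q+q^5+q^6}{1-q^8}. \]
   Context: $(a;q)_n=\prod_{i=0}^{n-1}(1-aq^i)$, $(a;q)_\infty=\prod_{i\ge0}(1-aq^i)$, $(a_1,\dots,a_k;q)_\infty=\prod_j(a_j;q)_\infty$. A partition $\lambda=(\lambda_1\ge\cdots\ge\lambda_k)$ has conjugate $\lambda'$ with $\lambda'_j=\#\{i:\lambda_i\ge j\}$; the hook length of cell $(i,j)$ is $\lambda_i+\lambda'_j-i-j+1$, and a $t$-hook is a cell of hook length $t$. $g_{1,1}(n)$ is the total number of $1$-hooks over all partitions of $n$ in which consecutive parts differ by at least $2$ and $\lambda_i-\lambda_{i+1}>2$ whenever $\lambda_i$ is odd (no two odd parts differ by exactly 2); $g_{2,1}(n)$ is the total number of $1$-hooks over all partitions of $n$ with all parts congruent to $1$, $5$ or $6$ modulo $8$. -}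

module Defs where

open import Data.Nat using (ℕ; zero; suc; _+_; _*_; _∸_; _⊓_; _≤ᵇ_; _<ᵇ_; _≡ᵇ_; _%_)
open import Data.Nat.Divisibility using (_∣?_)
open import Data.Bool using (Bool; true; false; if_then_else_; _∧_; _∨_; not)
open import Data.Nat.ListAction using (sum)
open import Data.List using (List; []; _∷_; map; upTo; length; filter; concatMap; foldr; [_])
open import Relation.Nullary.Decidable using (⌊_⌋)
open import Relation.Binary.PropositionalEquality using (_≡_; refl)

-- A partition is a non-increasing list of positive naturals
-- (λ₁ ≥ λ₂ ≥ ... ≥ λₖ > 0).
Partition : Set
Partition = List ℕ

-- partsF fuel n m : all partitions of n with largest part ≤ m
-- (each list once, parts in non-increasing order).  The fuel argument
-- only serves termination; fuel ≥ n suffices.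
partsF : ℕ → ℕ → ℕ → List Partition
partsF _        zero    m = [ [] ]
partsF zero     (suc n) m = []
partsF (suc f)  (suc n) m =
  concatMap (λ k → map (k ∷_) (partsF f (suc n ∸ k) k))
            (map suc (upTo (m ⊓ suc n)))

partitions : ℕ → List Partition
partitions n = partsF n n n

_ : length (partitions 5) ≡ 7
_ = refl
_ : length (partitions 10) ≡ 42
_ = refl

conj : Partition → ℕ → ℕ
conj λs j = length (filter (λ x → j Data.Nat.≤? x) λs)

-- hook length of cell (i , j): λ_i + λ'_j - i - j + 1
-- (for cells of the diagram, i.e. 1 ≤ i ≤ k, 1 ≤ j ≤ λ_i, this is ≥ 1,
--  so the truncated subtraction is the true value)
hook : Partition → ℕ → ℕ → ℕ → ℕ
hook λs i λi j = (λi + conj λs j + 1) ∸ (i + j)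

hooksRow : ℕ → Partition → ℕ → ℕ → ℕ
hooksRow t λs i λi =
  length (filter (λ j → hook λs i λi j Data.Nat.≟ t) (map suc (upTo λi)))

numHooksFrom : ℕ → Partition → ℕ → Partition → ℕ
numHooksFrom t λs i []         = 0
numHooksFrom t λs i (λi ∷ rest) = hooksRow t λs i λi + numHooksFrom t λs (suc i) rest

numHooks : ℕ → Partition → ℕ
numHooks t λs = numHooksFrom t λs 1 λs

_ : numHooks 1 (3 ∷ 1 ∷ []) ≡ 2
_ = refl
_ : numHooks 1 (4 ∷ 2 ∷ 2 ∷ 1 ∷ []) ≡ 3
_ = refl

odd? : ℕ → Bool
odd? a = (a % 2) ≡ᵇ 1

cond11 : Partition → Bool
cond11 []            = true
cond11 (a ∷ [])      = true
cond11 (a ∷ b ∷ rest) =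
  (2 ≤ᵇ (a ∸ b)) ∧ (not (odd? a) ∨ (2 <ᵇ (a ∸ b))) ∧ cond11 (b ∷ rest)

cond21 : Partition → Bool
cond21 []       = true
cond21 (a ∷ as) = ((a % 8 ≡ᵇ 1) ∨ (a % 8 ≡ᵇ 5) ∨ (a % 8 ≡ᵇ 6)) ∧ cond21 as

g11 : ℕ → ℕ
g11 n = sum (map (numHooks 1) (filter (λ p → cond11 p Data.Bool.≟ true) (partitions n)))

g21 : ℕ → ℕ
g21 n = sum (map (numHooks 1) (filter (λ p → cond21 p Data.Bool.≟ true) (partitions n)))

-- Formal power series in q with natural coefficients (all series in the
-- statement have nonnegative coefficients): f n = coefficient of q^n.

Series : Set
Series = ℕ → ℕ

_⊕_ : Series → Series → Series
infixl 6 _⊕_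
infixl 7 _⊛_
(f ⊕ g) n = f n + g n

_⊛_ : Series → Series → Series
(f ⊛ g) n = sum (map (λ i → f i * g (n ∸ i)) (upTo (suc n)))

scale : ℕ → Series → Series
scale c f n = c * f n

mono : ℕ → Series
mono k n = if n ≡ᵇ k then 1 else 0

one : Series
one = mono 0

-- 1 / (1 - q^k) = Σ_j q^{kj}   (used only for k ≥ 1)
geom : ℕ → Series
geom k n = if ⌊ k ∣? n ⌋ then 1 else 0

prodS : List Series → Series
prodS = foldr _⊛_ one

-- q^{n²+n} (-q^{-1};q²)_n = q^{n²} ∏_{i<n} q(1 + q^{2i-1}) = q^{n²} ∏_{i<n} (q + q^{2i})
-- 1/(q²;q²)_n = ∏_{i=1}^{n} 1/(1 - q^{2i})
term11 : ℕ → Series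
term11 n = scale n (mono (n * n)
             ⊛ (prodS (map (λ i → mono 1 ⊕ mono (2 * i)) (upTo n))
             ⊛ prodS (map (λ i → geom (2 * suc i)) (upTo n))))

-- Σ_{n≥0} term11 n ; term11 n = O(q^{n²}), so the coefficient of q^N only
-- receives contributions from n ≤ N.
rhs11 : Series
rhs11 N = sum (map (λ n → term11 n N) (upTo (suc N)))

-- 1/(q,q^5,q^6;q^8)_∞ = ∏_{i≥0} 1/((1-q^{8i+1})(1-q^{8i+5})(1-q^{8i+6})).
-- Factors with 8i+r > N are ≡ 1 mod q^{N+1}, so the coefficient of q^N is
-- that of the finite product over i ≤ N.
invProd1568 : Series
invProd1568 N =
  prodS (concatMap (λ i → geom (8 * i + 1) ∷ geom (8 * i + 5) ∷ geom (8 * i + 6) ∷ [])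
                   (upTo (suc N))) N

rhs21 : Series
rhs21 = invProd1568 ⊛ ((mono 1 ⊕ mono 5 ⊕ mono 6) ⊛ geom 8)

_ : map g11 (upTo 6) ≡ 0 ∷ 1 ∷ 1 ∷ 1 ∷ 1 ∷ 3 ∷ []
_ = refl
_ : map g21 (upTo 6) ≡ 0 ∷ 1 ∷ 1 ∷ 1 ∷ 1 ∷ 2 ∷ []
_ = refl
_ : map rhs11 (upTo 6) ≡ 0 ∷ 1 ∷ 1 ∷ 1 ∷ 1 ∷ 3 ∷ []
_ = refl
_ : map rhs21 (upTo 6) ≡ 0 ∷ 1 ∷ 1 ∷ 1 ∷ 1 ∷ 2 ∷ []
_ = refl

-- Both sides are generating functions of weighted sums over partitions; they are compared coefficientwise,
-- computing in the commutative semiring of power series with natural coefficients.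
-- A row of a partition ends in a 1-hook exactly when the next row is shorter, so numHooks 1 counts distinct parts.
-- For parts in a set S, sorting partitions by their largest part m gives equations F = A + q^m F, solved by
-- F = A / (1 - q^m). This yields ∏_{m ∈ S} 1/(1 - q^m) for the number of partitions and, as the part m brings a
-- new 1-hook exactly when it first occurs, that product times Σ_{m ∈ S} q^m for the number of 1-hooks.
-- The partitions of g_{1,1} have distinct parts, so they are counted with weight their number of parts k.
-- With gap c = 3 for odd c and 2 for even c, their condition says that each part is at least c + gap c when c is
-- the next part. Splitting off the smallest part shows that the generating functions F a k of such partitions
-- into k parts, all ≥ a, satisfy F a (k+1) = F (a+1) (k+1) + q^a F (a + gap a) k. The closed forms of the
-- paper for a = 1, 2, extended by F (a+2) k = q^{2k} F a k (add 2 to every part), satisfy the same recursion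
-- by the identity 1/(1 - x) = 1 + x/(1 - x), and the recursion determines F.

module Submission where

open import Defs
open import Data.Nat using (ℕ)
open import Data.Product using (_×_)
open import Relation.Binary.PropositionalEquality using (_≡_)

open import Relation.Binary.PropositionalEquality using (_≗_; refl; sym; trans; cong; cong₂; subst; isEquivalence; module ≡-Reasoning)

open import Algebra.Bundles using (CommutativeSemiring; CommutativeMonoid)
import Algebra.Construct.Pointwise ℕ as Pointwise
import Algebra.Solver.Ring.NaturalCoefficients.Default as NaturalCoefficientsSolver
open import Algebra.Structures (_≗_ {A = ℕ} {B = ℕ}) using (IsCommutativeMonoid)
open import Algebra.Structures.Biased (_≗_ {A = ℕ} {B = ℕ}) using (isCommutativeMonoidˡ; isCommutativeSemiringˡ)
open import Data.Bool using (Bool; true; false; if_then_else_; _∧_; _∨_; not; T)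
open import Data.Bool.Properties using (T-∧; ∧-assoc; ∧-identityʳ; ∧-zeroʳ; ∨-zeroʳ; ∧-commutativeMonoid) renaming (_≟_ to _≟ᵇ_)
open import Data.List using (List; []; _∷_; _∷ʳ_; [_]; _++_; map; upTo; applyUpTo; concat; concatMap; length; filter)
open import Data.List.Properties
  using (length-++; map-applyUpTo; applyUpTo-∷ʳ; map-upTo; upTo-∷ʳ; map-∘; map-cong; map-cong-local; map-++; concatMap-++)
open import Data.List.Relation.Unary.All as All using (All; []; _∷_)
open import Data.List.Relation.Unary.All.Properties using (concat⁺; map⁺; applyUpTo⁺₁)
open import Data.Nat using (zero; suc; _+_; _*_; _∸_; _⊓_; _≤_; _<_; z≤n; s≤s; z<s; s<s; _≤ᵇ_; _<ᵇ_; _≡ᵇ_; _≤?_; _≟_)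
open import Data.Nat.Divisibility using (_∣?_; ∣-refl; _∣0; ∣m∣n⇒∣m+n; ∣m+n∣m⇒∣n; >⇒∤)
open import Data.Nat.DivMod using (_%_; [m+n]%n≡m%n; [m+kn]%n≡m%n)
open import Data.Nat.Induction using (<-wellFounded)
open import Data.Nat.ListAction using (sum)
open import Data.Nat.ListAction.Properties using (sum-++)
open import Data.Nat.Properties
open import Data.Nat.Solver using (module +-*-Solver)
open import Data.Product using (_,_; proj₁; proj₂)
open import Data.Sum using (inj₁; inj₂)
open import Data.Unit using (tt)
open import Function using (_∘_)
open import Function.Bundles using (Equivalence; mk⇔)
open import Induction.WellFounded using (Acc; acc)
open import Level using (0ℓ)
open import Relation.Binary.Definitions using (tri<; tri≈; tri>)
import Relation.Binary.Reasoning.Setoid as SetoidReasoning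
open import Relation.Nullary using (yes; no; ¬_; contradiction)
open import Relation.Nullary.Decidable using (isYes; does; isYes≗does; does-⇔; dec-true; dec-false)

open import Algebra.Properties.CommutativeSemigroup +-commutativeSemigroup using () renaming (interchange to +-interchange)
open import Algebra.Properties.CommutativeSemigroup (CommutativeMonoid.commutativeSemigroup ∧-commutativeMonoid)
  using () renaming (interchange to ∧-interchange)


when : Bool → ℕ → ℕ
when b x = if b then x else 0

𝟙 : Bool → ℕ
𝟙 b = when b 1

when-true : ∀ {b} x → b ≡ true → when b x ≡ x
when-true x refl = refl

when-false : ∀ {b} x → b ≡ false → when b x ≡ 0
when-false x refl = refl

when-0 : ∀ b → when b 0 ≡ 0
when-0 true  = refl
when-0 false = refl

when-𝟙 : ∀ b c → when b (𝟙 c) ≡ 𝟙 (b ∧ c)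
when-𝟙 true  c = refl
when-𝟙 false c = refl

T⇒≡true : ∀ {b} → T b → b ≡ true
T⇒≡true {true} _ = refl

¬T⇒≡false : ∀ {b} → ¬ T b → b ≡ false
¬T⇒≡false {false} _  = refl
¬T⇒≡false {true}  ¬t = contradiction tt ¬t

≤ᵇ-true : ∀ {m n} → m ≤ n → (m ≤ᵇ n) ≡ true
≤ᵇ-true m≤n = T⇒≡true (≤⇒≤ᵇ m≤n)

≤ᵇ-false : ∀ {m n} → n < m → (m ≤ᵇ n) ≡ false
≤ᵇ-false {m} {n} n<m = ¬T⇒≡false (λ t → <⇒≱ n<m (≤ᵇ⇒≤ m n t))

<ᵇ-true : ∀ {m n} → m < n → (m <ᵇ n) ≡ true
<ᵇ-true m<n = T⇒≡true (<⇒<ᵇ m<n)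

<ᵇ-false : ∀ {m n} → n ≤ m → (m <ᵇ n) ≡ false
<ᵇ-false {m} {n} n≤m = ¬T⇒≡false (λ t → <⇒≱ (<ᵇ⇒< m n t) n≤m)

≤ᵇ-cong : ∀ {a b c d} → (a ≤ b → c ≤ d) → (c ≤ d → a ≤ b) → (a ≤ᵇ b) ≡ (c ≤ᵇ d)
≤ᵇ-cong {a} {b} to from with a ≤? b
... | yes a≤b = trans (≤ᵇ-true a≤b) (sym (≤ᵇ-true (to a≤b)))
... | no  a≰b = trans (¬T⇒≡false (λ t → a≰b (≤ᵇ⇒≤ _ _ t))) (sym (¬T⇒≡false (λ t → a≰b (from (≤ᵇ⇒≤ _ _ t)))))

∧-congˡ-under : ∀ {x x′} y → (T y → x ≡ x′) → x ∧ y ≡ x′ ∧ y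
∧-congˡ-under {x} {x′} false _  = trans (∧-zeroʳ x) (sym (∧-zeroʳ x′))
∧-congˡ-under          true  eq = cong (_∧ true) (eq tt)

Σ< : ℕ → (ℕ → ℕ) → ℕ
Σ< n f = sum (applyUpTo f n)

Σ<-snoc : ∀ n f → Σ< (suc n) f ≡ Σ< n f + f n
Σ<-snoc n f = begin
  sum (applyUpTo f (suc n))  ≡⟨ cong sum (applyUpTo-∷ʳ f n) ⟨
  sum (applyUpTo f n ∷ʳ f n) ≡⟨ sum-++ (applyUpTo f n) [ f n ] ⟩
  Σ< n f + (f n + 0)         ≡⟨ cong (Σ< n f +_) (+-identityʳ (f n)) ⟩
  Σ< n f + f n               ∎
  where open ≡-Reasoning

Σ<-cong : ∀ n {f g} → (∀ i → i < n → f i ≡ g i) → Σ< n f ≡ Σ< n g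
Σ<-cong zero    f≡g = refl
Σ<-cong (suc n) f≡g = cong₂ _+_ (f≡g 0 z<s) (Σ<-cong n (λ i i<n → f≡g (suc i) (s<s i<n)))

Σ<-zero : ∀ n {f} → (∀ i → i < n → f i ≡ 0) → Σ< n f ≡ 0
Σ<-zero zero    f≡0 = refl
Σ<-zero (suc n) f≡0 = cong₂ _+_ (f≡0 0 z<s) (Σ<-zero n (λ i i<n → f≡0 (suc i) (s<s i<n)))

Σ<-+ : ∀ n f g → Σ< n (λ i → f i + g i) ≡ Σ< n f + Σ< n g
Σ<-+ zero    f g = refl
Σ<-+ (suc n) f g = trans (cong (f 0 + g 0 +_) (Σ<-+ n (f ∘ suc) (g ∘ suc)))
                         (+-interchange (f 0) (g 0) _ _)

Σ<-*ˡ : ∀ n c f → Σ< n (λ i → c * f i) ≡ c * Σ< n f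
Σ<-*ˡ zero    c f = sym (*-zeroʳ c)
Σ<-*ˡ (suc n) c f = trans (cong (c * f 0 +_) (Σ<-*ˡ n c (f ∘ suc))) (sym (*-distribˡ-+ c (f 0) _))

Σ<-*ʳ : ∀ n c f → Σ< n (λ i → f i * c) ≡ Σ< n f * c
Σ<-*ʳ n c f = begin
  Σ< n (λ i → f i * c) ≡⟨ Σ<-cong n (λ i _ → *-comm (f i) c) ⟩
  Σ< n (λ i → c * f i) ≡⟨ Σ<-*ˡ n c f ⟩
  c * Σ< n f           ≡⟨ *-comm c _ ⟩
  Σ< n f * c           ∎
  where open ≡-Reasoning

Σ<-reverse : ∀ n f → Σ< n f ≡ Σ< n (λ i → f (n ∸ suc i))
Σ<-reverse zero    f = refl
Σ<-reverse (suc n) f = begin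
  f 0 + Σ< n (f ∘ suc)                     ≡⟨ cong (f 0 +_) (Σ<-reverse n (f ∘ suc)) ⟩
  f 0 + Σ< n (λ i → f (suc (n ∸ suc i)))   ≡⟨ cong (f 0 +_) (Σ<-cong n (λ i i<n → cong f (+-∸-assoc 1 i<n))) ⟨
  f 0 + Σ< n (λ i → f (n ∸ i))             ≡⟨ +-comm (f 0) _ ⟩
  Σ< n (λ i → f (n ∸ i)) + f 0             ≡⟨ cong (λ j → Σ< n (λ i → f (n ∸ i)) + f j) (n∸n≡0 n) ⟨
  Σ< n (λ i → f (n ∸ i)) + f (n ∸ n)       ≡⟨ Σ<-snoc n (λ i → f (n ∸ i)) ⟨
  Σ< (suc n) (λ i → f (n ∸ i))             ∎
  where open ≡-Reasoning

Σ<-triangle : ∀ n (F : ℕ → ℕ → ℕ) →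
  Σ< (suc n) (λ i → Σ< (suc i) (λ j → F j i)) ≡ Σ< (suc n) (λ j → Σ< (suc (n ∸ j)) (λ k → F j (j + k)))
Σ<-triangle zero    F = refl
Σ<-triangle (suc n) F = begin
  Σ< (suc (suc n)) (λ i → Σ< (suc i) (λ j → F j i))
    ≡⟨ Σ<-snoc (suc n) (λ i → Σ< (suc i) (λ j → F j i)) ⟩
  Σ< (suc n) (λ i → Σ< (suc i) (λ j → F j i)) + Σ< (suc (suc n)) (λ j → F j (suc n))
    ≡⟨ cong₂ _+_ (Σ<-triangle n F) (Σ<-snoc (suc n) (λ j → F j (suc n))) ⟩
  Σ< (suc n) H + (Σ< (suc n) (λ j → F j (suc n)) + F (suc n) (suc n))
    ≡⟨ +-assoc (Σ< (suc n) H) _ _ ⟨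
  Σ< (suc n) H + Σ< (suc n) (λ j → F j (suc n)) + F (suc n) (suc n)
    ≡⟨ cong₂ _+_ (Σ<-+ (suc n) H (λ j → F j (suc n))) last ⟨
  Σ< (suc n) (λ j → H j + F j (suc n)) + G (suc n)
    ≡⟨ cong (_+ G (suc n)) (Σ<-cong (suc n) (λ j j≤n → extend j (≤-pred j≤n))) ⟩
  Σ< (suc n) G + G (suc n)
    ≡⟨ Σ<-snoc (suc n) G ⟨
  Σ< (suc (suc n)) G ∎
  where
  open ≡-Reasoning
  H G : ℕ → ℕ
  H j = Σ< (suc (n ∸ j)) (λ k → F j (j + k))
  G j = Σ< (suc (suc n ∸ j)) (λ k → F j (j + k))
  extend : ∀ j → j ≤ n → H j + F j (suc n) ≡ G j
  extend j j≤n = begin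
    H j + F j (suc n)
      ≡⟨ cong (λ m → H j + F j m) (trans (+-suc j (n ∸ j)) (cong suc (m+[n∸m]≡n j≤n))) ⟨
    H j + F j (j + suc (n ∸ j))
      ≡⟨ Σ<-snoc (suc (n ∸ j)) (λ k → F j (j + k)) ⟨
    Σ< (suc (suc (n ∸ j))) (λ k → F j (j + k))
      ≡⟨ cong (λ m → Σ< (suc m) (λ k → F j (j + k))) (+-∸-assoc 1 j≤n) ⟨
    G j ∎
  last : G (suc n) ≡ F (suc n) (suc n)
  last = begin
    Σ< (suc (n ∸ n)) (λ k → F (suc n) (suc n + k)) ≡⟨ cong (λ m → Σ< (suc m) (λ k → F (suc n) (suc n + k))) (n∸n≡0 n) ⟩
    F (suc n) (suc n + 0) + 0                      ≡⟨ +-identityʳ _ ⟩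
    F (suc n) (suc n + 0)                          ≡⟨ cong (F (suc n)) (+-identityʳ (suc n)) ⟩
    F (suc n) (suc n)                              ∎

Σ<-indicator : ∀ K L → L < K → Σ< K (λ k → k * 𝟙 (L ≡ᵇ k)) ≡ L
Σ<-indicator (suc K) L L<1+K with m≤n⇒m<n∨m≡n (≤-pred L<1+K)
... | inj₁ L<K  = begin
  Σ< (suc K) (λ k → k * 𝟙 (L ≡ᵇ k))
    ≡⟨ Σ<-snoc K (λ k → k * 𝟙 (L ≡ᵇ k)) ⟩
  Σ< K (λ k → k * 𝟙 (L ≡ᵇ k)) + K * 𝟙 (L ≡ᵇ K)
    ≡⟨ cong₂ _+_ (Σ<-indicator K L L<K) (cong (λ b → K * 𝟙 b) (¬T⇒≡false (λ t → <⇒≢ L<K (≡ᵇ⇒≡ L K t)))) ⟩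
  L + K * 0
    ≡⟨ trans (cong (L +_) (*-zeroʳ K)) (+-identityʳ L) ⟩
  L ∎
  where open ≡-Reasoning
... | inj₂ refl = begin
  Σ< (suc L) (λ k → k * 𝟙 (L ≡ᵇ k))
    ≡⟨ Σ<-snoc L (λ k → k * 𝟙 (L ≡ᵇ k)) ⟩
  Σ< L (λ k → k * 𝟙 (L ≡ᵇ k)) + L * 𝟙 (L ≡ᵇ L)
    ≡⟨ cong₂ _+_ (Σ<-zero L others) (cong (λ b → L * 𝟙 b) (T⇒≡true (≡⇒≡ᵇ L L refl))) ⟩
  0 + L * 1
    ≡⟨ *-identityʳ L ⟩
  L ∎
  where
  open ≡-Reasoning
  others : ∀ k → k < L → k * 𝟙 (L ≡ᵇ k) ≡ 0
  others k k<L = trans (cong (λ b → k * 𝟙 b) (¬T⇒≡false (λ t → <⇒≢ k<L (sym (≡ᵇ⇒≡ L k t))))) (*-zeroʳ k)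

sum-map-filter : ∀ {A : Set} (c : A → Bool) f xs →
  sum (map f (filter (λ x → c x ≟ᵇ true) xs)) ≡ sum (map (λ x → when (c x) (f x)) xs)
sum-map-filter c f []       = refl
sum-map-filter c f (x ∷ xs) with c x
... | true  = cong (f x +_) (sum-map-filter c f xs)
... | false = sum-map-filter c f xs

sum-map-+ : ∀ {A : Set} (f g : A → ℕ) xs → sum (map (λ x → f x + g x) xs) ≡ sum (map f xs) + sum (map g xs)
sum-map-+ f g []       = refl
sum-map-+ f g (x ∷ xs) = trans (cong (f x + g x +_) (sum-map-+ f g xs)) (+-interchange (f x) (g x) _ _)

sum-map-*ˡ : ∀ {A : Set} c (f : A → ℕ) xs → sum (map (λ x → c * f x) xs) ≡ c * sum (map f xs)
sum-map-*ˡ c f []       = sym (*-zeroʳ c)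
sum-map-*ˡ c f (x ∷ xs) = trans (cong (c * f x +_) (sum-map-*ˡ c f xs)) (sym (*-distribˡ-+ c (f x) _))

sum-map-0 : ∀ {A : Set} (xs : List A) → sum (map (λ _ → 0) xs) ≡ 0
sum-map-0 []       = refl
sum-map-0 (x ∷ xs) = sum-map-0 xs

sum-map-concat : ∀ {A : Set} (w : A → ℕ) xss → sum (map w (concat xss)) ≡ sum (map (λ xs → sum (map w xs)) xss)
sum-map-concat w []         = refl
sum-map-concat w (xs ∷ xss) = begin
  sum (map w (xs ++ concat xss))                ≡⟨ cong sum (map-++ w xs (concat xss)) ⟩
  sum (map w xs ++ map w (concat xss))          ≡⟨ sum-++ (map w xs) _ ⟩
  sum (map w xs) + sum (map w (concat xss))     ≡⟨ cong (sum (map w xs) +_) (sum-map-concat w xss) ⟩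
  sum (map w xs) + sum (map (λ ys → sum (map w ys)) xss) ∎
  where open ≡-Reasoning

length-filter-≟ : ∀ (f : ℕ → ℕ) t xs → length (filter (λ j → f j ≟ t) xs) ≡ sum (map (λ j → 𝟙 (f j ≡ᵇ t)) xs)
length-filter-≟ f t []       = refl
length-filter-≟ f t (x ∷ xs) with f x ≡ᵇ t
... | true  = cong suc (length-filter-≟ f t xs)
... | false = length-filter-≟ f t xs


-- Formal power series

𝟘 : Series
𝟘 _ = 0

coeff-⊛ : ∀ f g n → (f ⊛ g) n ≡ Σ< (suc n) (λ i → f i * g (n ∸ i))
coeff-⊛ f g n = cong sum (map-upTo (λ i → f i * g (n ∸ i)) (suc n))

⊛-cong : ∀ {f f′ g g′} → f ≗ f′ → g ≗ g′ → f ⊛ g ≗ f′ ⊛ g′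
⊛-cong {f} {f′} {g} {g′} f≗f′ g≗g′ n = begin
  (f ⊛ g) n                               ≡⟨ coeff-⊛ f g n ⟩
  Σ< (suc n) (λ i → f i * g (n ∸ i))      ≡⟨ Σ<-cong (suc n) (λ i _ → cong₂ _*_ (f≗f′ i) (g≗g′ (n ∸ i))) ⟩
  Σ< (suc n) (λ i → f′ i * g′ (n ∸ i))    ≡⟨ coeff-⊛ f′ g′ n ⟨
  (f′ ⊛ g′) n                             ∎
  where open ≡-Reasoning

⊛-congˡ : ∀ f {g g′} → g ≗ g′ → f ⊛ g ≗ f ⊛ g′
⊛-congˡ f = ⊛-cong {f = f} (λ _ → refl)

⊛-congʳ : ∀ g {f f′} → f ≗ f′ → f ⊛ g ≗ f′ ⊛ g
⊛-congʳ g f≗f′ = ⊛-cong {g = g} f≗f′ (λ _ → refl)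

⊛-comm : ∀ f g → f ⊛ g ≗ g ⊛ f
⊛-comm f g n = begin
  (f ⊛ g) n                                          ≡⟨ coeff-⊛ f g n ⟩
  Σ< (suc n) (λ i → f i * g (n ∸ i))                 ≡⟨ Σ<-reverse (suc n) (λ i → f i * g (n ∸ i)) ⟩
  Σ< (suc n) (λ i → f (n ∸ i) * g (n ∸ (n ∸ i)))     ≡⟨ Σ<-cong (suc n) swap ⟩
  Σ< (suc n) (λ i → g i * f (n ∸ i))                 ≡⟨ coeff-⊛ g f n ⟨
  (g ⊛ f) n                                          ∎
  where
  open ≡-Reasoning
  swap : ∀ i → i < suc n → f (n ∸ i) * g (n ∸ (n ∸ i)) ≡ g i * f (n ∸ i)
  swap i i≤n = trans (cong (λ j → f (n ∸ i) * g j) (m∸[m∸n]≡n (≤-pred i≤n))) (*-comm (f (n ∸ i)) (g i))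

⊛-assoc : ∀ f g h → (f ⊛ g) ⊛ h ≗ f ⊛ (g ⊛ h)
⊛-assoc f g h n = begin
  ((f ⊛ g) ⊛ h) n
    ≡⟨ coeff-⊛ (f ⊛ g) h n ⟩
  Σ< (suc n) (λ i → (f ⊛ g) i * h (n ∸ i))
    ≡⟨ Σ<-cong (suc n) (λ i _ → trans (cong (_* h (n ∸ i)) (coeff-⊛ f g i))
                                      (sym (Σ<-*ʳ (suc i) (h (n ∸ i)) (λ j → f j * g (i ∸ j))))) ⟩
  Σ< (suc n) (λ i → Σ< (suc i) (λ j → f j * g (i ∸ j) * h (n ∸ i)))
    ≡⟨ Σ<-triangle n (λ j i → f j * g (i ∸ j) * h (n ∸ i)) ⟩
  Σ< (suc n) (λ j → Σ< (suc (n ∸ j)) (λ k → f j * g (j + k ∸ j) * h (n ∸ (j + k))))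
    ≡⟨ Σ<-cong (suc n) (λ j _ → Σ<-cong (suc (n ∸ j)) (λ k _ → regroup j k)) ⟩
  Σ< (suc n) (λ j → Σ< (suc (n ∸ j)) (λ k → f j * (g k * h (n ∸ j ∸ k))))
    ≡⟨ Σ<-cong (suc n) (λ j _ → trans (Σ<-*ˡ (suc (n ∸ j)) (f j) (λ k → g k * h (n ∸ j ∸ k)))
                                      (cong (f j *_) (sym (coeff-⊛ g h (n ∸ j))))) ⟩
  Σ< (suc n) (λ j → f j * (g ⊛ h) (n ∸ j))
    ≡⟨ coeff-⊛ f (g ⊛ h) n ⟨
  (f ⊛ (g ⊛ h)) n ∎
  where
  open ≡-Reasoning
  regroup : ∀ j k → f j * g (j + k ∸ j) * h (n ∸ (j + k)) ≡ f j * (g k * h (n ∸ j ∸ k))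
  regroup j k = begin
    f j * g (j + k ∸ j) * h (n ∸ (j + k)) ≡⟨ cong₂ (λ x y → f j * g x * h y) (m+n∸m≡n j k) (sym (∸-+-assoc n j k)) ⟩
    f j * g k * h (n ∸ j ∸ k)             ≡⟨ *-assoc (f j) (g k) _ ⟩
    f j * (g k * h (n ∸ j ∸ k))           ∎

⊛-identityˡ : ∀ f → one ⊛ f ≗ f
⊛-identityˡ f n = begin
  (one ⊛ f) n                                      ≡⟨ coeff-⊛ one f n ⟩
  f n + 0 + Σ< n (λ i → 0 * f (n ∸ suc i))         ≡⟨ cong (f n + 0 +_) (Σ<-zero n (λ _ _ → refl)) ⟩
  f n + 0 + 0                                      ≡⟨ trans (+-identityʳ _) (+-identityʳ _) ⟩
  f n                                              ∎
  where open ≡-Reasoning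

⊛-identityʳ : ∀ f → f ⊛ one ≗ f
⊛-identityʳ f n = trans (⊛-comm f one n) (⊛-identityˡ f n)

⊛-distribʳ : ∀ f g h → (g ⊕ h) ⊛ f ≗ g ⊛ f ⊕ h ⊛ f
⊛-distribʳ f g h n = begin
  ((g ⊕ h) ⊛ f) n
    ≡⟨ coeff-⊛ (g ⊕ h) f n ⟩
  Σ< (suc n) (λ i → (g i + h i) * f (n ∸ i))
    ≡⟨ Σ<-cong (suc n) (λ i _ → *-distribʳ-+ (f (n ∸ i)) (g i) (h i)) ⟩
  Σ< (suc n) (λ i → g i * f (n ∸ i) + h i * f (n ∸ i))
    ≡⟨ Σ<-+ (suc n) (λ i → g i * f (n ∸ i)) (λ i → h i * f (n ∸ i)) ⟩
  Σ< (suc n) (λ i → g i * f (n ∸ i)) + Σ< (suc n) (λ i → h i * f (n ∸ i))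
    ≡⟨ cong₂ _+_ (coeff-⊛ g f n) (coeff-⊛ h f n) ⟨
  (g ⊛ f) n + (h ⊛ f) n ∎
  where open ≡-Reasoning

⊛-distribˡ : ∀ f g h → f ⊛ (g ⊕ h) ≗ f ⊛ g ⊕ f ⊛ h
⊛-distribˡ f g h n = trans (⊛-comm f (g ⊕ h) n) (trans (⊛-distribʳ f g h n) (cong₂ _+_ (⊛-comm g f n) (⊛-comm h f n)))

⊛-zeroˡ : ∀ f → 𝟘 ⊛ f ≗ 𝟘
⊛-zeroˡ f n = trans (coeff-⊛ 𝟘 f n) (Σ<-zero (suc n) (λ _ _ → refl))

series : CommutativeSemiring 0ℓ 0ℓ
series = record
  { Carrier = Series
  ; _≈_ = _≗_
  ; _+_ = _⊕_
  ; _*_ = _⊛_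
  ; 0# = 𝟘
  ; 1# = one
  ; isCommutativeSemiring = isCommutativeSemiringˡ record
    { +-isCommutativeMonoid = Pointwise.isCommutativeMonoid +-0-isCommutativeMonoid
    ; *-isCommutativeMonoid = ⊛-isCommutativeMonoid
    ; distribʳ = ⊛-distribʳ
    ; zeroˡ = ⊛-zeroˡ
    }
  }
  where
  ⊛-isCommutativeMonoid : IsCommutativeMonoid _⊛_ one
  ⊛-isCommutativeMonoid = isCommutativeMonoidˡ record
    { isSemigroup = record
      { isMagma = record { isEquivalence = Pointwise.isEquivalence isEquivalence ; ∙-cong = ⊛-cong }
      ; assoc = ⊛-assoc
      }
    ; identityˡ = ⊛-identityˡ
    ; comm = ⊛-comm
    }

module ⊛-Solver = NaturalCoefficientsSolver series

open CommutativeSemiring series using () renaming (refl to ≗-refl; sym to ≗-sym; trans to ≗-trans; setoid to ≗-setoid)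

module ≗-Reasoning = SetoidReasoning ≗-setoid

mono-⊛-suc : ∀ k f n → (mono (suc k) ⊛ f) (suc n) ≡ (mono k ⊛ f) n
mono-⊛-suc k f n = trans (coeff-⊛ (mono (suc k)) f (suc n)) (sym (coeff-⊛ (mono k) f n))

mono-⊛-+ : ∀ k f n → (mono k ⊛ f) (k + n) ≡ f n
mono-⊛-+ zero    f n = ⊛-identityˡ f n
mono-⊛-+ (suc k) f n = trans (mono-⊛-suc k f (k + n)) (mono-⊛-+ k f n)

mono-⊛-≥ : ∀ k f {n} → k ≤ n → (mono k ⊛ f) n ≡ f (n ∸ k)
mono-⊛-≥ k f k≤n = trans (cong (mono k ⊛ f) (sym (m+[n∸m]≡n k≤n))) (mono-⊛-+ k f _)

mono-⊛-< : ∀ k f {n} → n < k → (mono k ⊛ f) n ≡ 0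
mono-⊛-< (suc k) f {zero}  _         = refl
mono-⊛-< (suc k) f {suc n} (s<s n<k) = trans (mono-⊛-suc k f n) (mono-⊛-< k f n<k)

mono-⊛-local : ∀ k {F G} n → (k ≤ n → F (n ∸ k) ≡ G (n ∸ k)) → (mono k ⊛ F) n ≡ (mono k ⊛ G) n
mono-⊛-local k {F} {G} n eq with k ≤? n
... | yes k≤n = trans (mono-⊛-≥ k F k≤n) (trans (eq k≤n) (sym (mono-⊛-≥ k G k≤n)))
... | no  k≰n = trans (mono-⊛-< k F (≰⇒> k≰n)) (sym (mono-⊛-< k G (≰⇒> k≰n)))

mono-⊛-𝟘 : ∀ k {F} → F ≗ 𝟘 → mono k ⊛ F ≗ 𝟘
mono-⊛-𝟘 k {F} F≗𝟘 n = trans (⊛-congˡ (mono k) F≗𝟘 n) (trans (⊛-comm (mono k) 𝟘 n) (⊛-zeroˡ (mono k) n))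

mono-+ : ∀ j k → mono (j + k) ≗ mono j ⊛ mono k
mono-+ zero    k n       = sym (⊛-identityˡ (mono k) n)
mono-+ (suc j) k zero    = refl
mono-+ (suc j) k (suc n) = trans (mono-+ j k n) (sym (mono-⊛-suc j (mono k) n))

mono-cong : ∀ {i j} → i ≡ j → mono i ≗ mono j
mono-cong i≡j n = cong (λ e → mono e n) i≡j

mono-⊛-mono : ∀ i j F → mono i ⊛ (mono j ⊛ F) ≗ mono (i + j) ⊛ F
mono-⊛-mono i j F = ≗-trans (≗-sym (⊛-assoc (mono i) (mono j) F)) (⊛-cong (≗-sym (mono-+ i j)) ≗-refl)

mono-⊛-mono-swap : ∀ {i j i′ j′} F → i + j ≡ i′ + j′ → mono i ⊛ (mono j ⊛ F) ≗ mono i′ ⊛ (mono j′ ⊛ F)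
mono-⊛-mono-swap {i} {j} {i′} {j′} F eq =
  ≗-trans (mono-⊛-mono i j F) (≗-trans (⊛-congʳ F (mono-cong eq)) (≗-sym (mono-⊛-mono i′ j′ F)))

geom-periodic : ∀ k r → geom k (k + r) ≡ geom k r
geom-periodic k r = cong (λ b → if b then 1 else 0) (begin
  isYes (k ∣? (k + r)) ≡⟨ isYes≗does (k ∣? (k + r)) ⟩
  does (k ∣? (k + r))  ≡⟨ does-⇔ (mk⇔ (λ k∣k+r → ∣m+n∣m⇒∣n k∣k+r ∣-refl) (∣m∣n⇒∣m+n ∣-refl))
                                 (k ∣? (k + r)) (k ∣? r) ⟩
  does (k ∣? r)        ≡⟨ isYes≗does (k ∣? r) ⟨
  isYes (k ∣? r)       ∎)
  where open ≡-Reasoning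

geom-unfold : ∀ k → geom (suc k) ≗ one ⊕ mono (suc k) ⊛ geom (suc k)
geom-unfold k zero = cong (λ b → if b then 1 else 0) (trans (isYes≗does (suc k ∣? 0)) (dec-true (suc k ∣? 0) (suc k ∣0)))
geom-unfold k (suc n) with suc k ≤? suc n
... | yes k<n = begin
  geom (suc k) (suc n)                          ≡⟨ cong (geom (suc k)) (m+[n∸m]≡n k<n) ⟨
  geom (suc k) (suc k + (n ∸ k))                ≡⟨ geom-periodic (suc k) (n ∸ k) ⟩
  geom (suc k) (n ∸ k)                          ≡⟨ mono-⊛-≥ (suc k) (geom (suc k)) k<n ⟨
  (mono (suc k) ⊛ geom (suc k)) (suc n)         ∎
  where open ≡-Reasoning
... | no n≤k = trans (cong (λ b → if b then 1 else 0) (trans (isYes≗does (suc k ∣? suc n)) (dec-false (suc k ∣? suc n) k∤n)))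
                     (sym (mono-⊛-< (suc k) (geom (suc k)) (≰⇒> n≤k)))
  where k∤n = >⇒∤ (≰⇒> n≤k)

geom-⊛-unfold : ∀ k A → geom (suc k) ⊛ A ≗ A ⊕ mono (suc k) ⊛ (geom (suc k) ⊛ A)
geom-⊛-unfold k A = begin
  geom (suc k) ⊛ A
    ≈⟨ ⊛-cong (geom-unfold k) ≗-refl ⟩
  (one ⊕ mono (suc k) ⊛ geom (suc k)) ⊛ A
    ≈⟨ solve 3 (λ a x g → (con 1 :+ x :* g) :* a := a :+ x :* (g :* a)) ≗-refl A (mono (suc k)) (geom (suc k)) ⟩
  A ⊕ mono (suc k) ⊛ (geom (suc k) ⊛ A) ∎
  where
  open ≗-Reasoning
  open ⊛-Solver

geom-⊛-≤ : ∀ k A {i} → i ≤ k → (geom (suc k) ⊛ A) i ≡ A i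
geom-⊛-≤ k A i≤k = trans (geom-⊛-unfold k A _)
                          (trans (cong (A _ +_) (mono-⊛-< (suc k) (geom (suc k) ⊛ A) (s≤s i≤k))) (+-identityʳ _))

Agree≤ : ℕ → Series → Series → Set
Agree≤ n f g = ∀ i → i ≤ n → f i ≡ g i

Agree≤-suc : ∀ {n f g} → Agree≤ n f g → f (suc n) ≡ g (suc n) → Agree≤ (suc n) f g
Agree≤-suc agree eq i i≤1+n with m≤n⇒m<n∨m≡n i≤1+n
... | inj₁ i<1+n = agree i (≤-pred i<1+n)
... | inj₂ refl  = eq

⊛-cong≤ : ∀ {n f f′ g g′} → Agree≤ n f f′ → Agree≤ n g g′ → Agree≤ n (f ⊛ g) (f′ ⊛ g′)
⊛-cong≤ {n} {f} {f′} {g} {g′} f≈f′ g≈g′ i i≤n = begin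
  (f ⊛ g) i                               ≡⟨ coeff-⊛ f g i ⟩
  Σ< (suc i) (λ j → f j * g (i ∸ j))      ≡⟨ Σ<-cong (suc i) (λ j j≤i → cong₂ _*_ (f≈f′ j (≤-trans (≤-pred j≤i) i≤n))
                                                                            (g≈g′ (i ∸ j) (≤-trans (m∸n≤m i j) i≤n))) ⟩
  Σ< (suc i) (λ j → f′ j * g′ (i ∸ j))    ≡⟨ coeff-⊛ f′ g′ i ⟨
  (f′ ⊛ g′) i                             ∎
  where open ≡-Reasoning

-- The coefficient of q^{n+1} in q^{k+1} F only involves coefficients of F below n + 1.
mono-suc-fixpoint-unique : ∀ k {A F G} → F ≗ A ⊕ mono (suc k) ⊛ F → G ≗ A ⊕ mono (suc k) ⊛ G → F ≗ G
mono-suc-fixpoint-unique k {A} {F} {G} F≗ G≗ n = agree n n ≤-refl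
  where
  agree : ∀ n → Agree≤ n F G
  agree zero    zero z≤n = trans (F≗ 0) (sym (G≗ 0))
  agree (suc n) = Agree≤-suc (agree n) (begin
    F (suc n)                               ≡⟨ F≗ (suc n) ⟩
    A (suc n) + (mono (suc k) ⊛ F) (suc n)  ≡⟨ cong (A (suc n) +_) (mono-⊛-suc k F n) ⟩
    A (suc n) + (mono k ⊛ F) n              ≡⟨ cong (A (suc n) +_) (⊛-cong≤ {f = mono k} (λ _ _ → refl) (agree n) n ≤-refl) ⟩
    A (suc n) + (mono k ⊛ G) n              ≡⟨ cong (A (suc n) +_) (mono-⊛-suc k G n) ⟨
    A (suc n) + (mono (suc k) ⊛ G) (suc n)  ≡⟨ G≗ (suc n) ⟨
    G (suc n)                               ∎)
    where open ≡-Reasoning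

mono-suc-fixpoint : ∀ k {A F} → F ≗ A ⊕ mono (suc k) ⊛ F → F ≗ geom (suc k) ⊛ A
mono-suc-fixpoint k {A} F≗ = mono-suc-fixpoint-unique k F≗ (geom-⊛-unfold k A)

prodS-++ : ∀ xs ys → prodS (xs ++ ys) ≗ prodS xs ⊛ prodS ys
prodS-++ []       ys = ≗-sym (⊛-identityˡ (prodS ys))
prodS-++ (x ∷ xs) ys = ≗-trans (⊛-congˡ x (prodS-++ xs ys)) (≗-sym (⊛-assoc x (prodS xs) (prodS ys)))

prodS-map-upTo-suc : ∀ (f : ℕ → Series) k → prodS (map f (upTo (suc k))) ≗ prodS (map f (upTo k)) ⊛ f k
prodS-map-upTo-suc f k = begin
  prodS (map f (upTo (suc k)))               ≡⟨ cong (prodS ∘ map f) (upTo-∷ʳ k) ⟨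
  prodS (map f (upTo k ∷ʳ k))                ≡⟨ cong prodS (map-++ f (upTo k) [ k ]) ⟩
  prodS (map f (upTo k) ++ [ f k ])          ≈⟨ prodS-++ (map f (upTo k)) [ f k ] ⟩
  prodS (map f (upTo k)) ⊛ (f k ⊛ one)       ≈⟨ ⊛-congˡ (prodS (map f (upTo k))) (⊛-identityʳ (f k)) ⟩
  prodS (map f (upTo k)) ⊛ f k               ∎
  where open ≗-Reasoning

prodS-applyUpTo-mono1 : ∀ k {F G : ℕ → Series} → (∀ i → F i ≗ mono 1 ⊛ G i) →
  prodS (applyUpTo F k) ≗ mono k ⊛ prodS (applyUpTo G k)
prodS-applyUpTo-mono1 zero    F≗ = ≗-sym (⊛-identityˡ one)
prodS-applyUpTo-mono1 (suc k) {F} {G} F≗ = begin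
  F 0 ⊛ prodS (applyUpTo (F ∘ suc) k)
    ≈⟨ ⊛-cong (F≗ 0) (prodS-applyUpTo-mono1 k (F≗ ∘ suc)) ⟩
  (mono 1 ⊛ G 0) ⊛ (mono k ⊛ prodS (applyUpTo (G ∘ suc) k))
    ≈⟨ solve 4 (λ x g y p → (x :* g) :* (y :* p) := (x :* y) :* (g :* p)) ≗-refl
               (mono 1) (G 0) (mono k) (prodS (applyUpTo (G ∘ suc) k)) ⟩
  (mono 1 ⊛ mono k) ⊛ (G 0 ⊛ prodS (applyUpTo (G ∘ suc) k))
    ≈⟨ ⊛-congʳ (G 0 ⊛ prodS (applyUpTo (G ∘ suc) k)) (≗-sym (mono-+ 1 k)) ⟩
  mono (suc k) ⊛ prodS (applyUpTo G (suc k)) ∎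
  where
  open ≗-Reasoning
  open ⊛-Solver


-- Sums over partitions

data Partition≤ : ℕ → Partition → Set where
  []   : ∀ {m} → Partition≤ m []
  cons : ∀ {m k p} → 1 ≤ k → k ≤ m → Partition≤ k p → Partition≤ m (k ∷ p)

Partition≤-mono : ∀ {m m′ p} → m ≤ m′ → Partition≤ m p → Partition≤ m′ p
Partition≤-mono m≤m′ []               = []
Partition≤-mono m≤m′ (cons 1≤k k≤m π) = cons 1≤k (≤-trans k≤m m≤m′) π

largestPart : Partition → ℕ
largestPart []      = 0
largestPart (k ∷ _) = k

largestPart≤ : ∀ {m p} → Partition≤ m p → largestPart p ≤ m
largestPart≤ []              = z≤n
largestPart≤ (cons _ k≤m _) = k≤m

length≤sum : ∀ {m p} → Partition≤ m p → length p ≤ sum p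
length≤sum []             = z≤n
length≤sum (cons 1≤k _ π) = +-mono-≤ 1≤k (length≤sum π)

partsF-sound : ∀ f n m → All (λ p → Partition≤ m p × sum p ≡ n) (partsF f n m)
partsF-sound f       zero    m = ([] , refl) ∷ []
partsF-sound zero    (suc n) m = []
partsF-sound (suc f) (suc n) m = concat⁺ (map⁺ (map⁺ (applyUpTo⁺₁ (λ i → i) (m ⊓ suc n) largest)))
  where
  largest : ∀ {i} → i < m ⊓ suc n → All (λ p → Partition≤ m p × sum p ≡ suc n) (map (suc i ∷_) (partsF f (n ∸ i) (suc i)))
  largest {i} i<m⊓n = map⁺ (All.map (λ (π , Σp) → cons (s≤s z≤n) (≤-trans i<m⊓n (m⊓n≤m m (suc n))) π ,
                                                  cong suc (trans (cong (i +_) Σp) (m+[n∸m]≡n i≤n)))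
                                    (partsF-sound f (n ∸ i) (suc i)))
    where i≤n = ≤-pred (≤-trans i<m⊓n (m⊓n≤n m (suc n)))

partsF-fuel : ∀ f g n m → n ≤ f → n ≤ g → partsF f n m ≡ partsF g n m
partsF-fuel f       g       zero    m _         _         = refl
partsF-fuel (suc f) (suc g) (suc n) m (s≤s n≤f) (s≤s n≤g) =
  cong concat (trans (sym (map-∘ (upTo (m ⊓ suc n))))
              (trans (map-cong (λ i → cong (map (suc i ∷_)) (partsF-fuel f g (n ∸ i) (suc i)
                                          (≤-trans (m∸n≤m n i) n≤f) (≤-trans (m∸n≤m n i) n≤g))) (upTo (m ⊓ suc n)))
                     (map-∘ (upTo (m ⊓ suc n)))))

ΣP : ℕ → (Partition → ℕ) → Series
ΣP m w n = sum (map w (partsF n n m))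

ΣP-congᴾ : ∀ m {w w′} n → (∀ p → Partition≤ m p → sum p ≡ n → w p ≡ w′ p) → ΣP m w n ≡ ΣP m w′ n
ΣP-congᴾ m n w≡w′ = cong sum (map-cong-local (All.map (λ (π , Σp) → w≡w′ _ π Σp) (partsF-sound n n m)))

ΣP-cong : ∀ m {w w′} → w ≗ w′ → ΣP m w ≗ ΣP m w′
ΣP-cong m w≗w′ n = cong sum (map-cong w≗w′ (partsF n n m))

ΣP-+ : ∀ m w w′ → ΣP m (λ p → w p + w′ p) ≗ ΣP m w ⊕ ΣP m w′
ΣP-+ m w w′ n = sum-map-+ w w′ (partsF n n m)

ΣP-*ˡ : ∀ m c w n → ΣP m (λ p → c * w p) n ≡ c * ΣP m w n
ΣP-*ˡ m c w n = sum-map-*ˡ c w (partsF n n m)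

ΣP-𝟘 : ∀ m → ΣP m (λ _ → 0) ≗ 𝟘
ΣP-𝟘 m n = sum-map-0 (partsF n n m)

ΣP-Σ< : ∀ m K (f : ℕ → Partition → ℕ) n → ΣP m (λ p → Σ< K (λ k → f k p)) n ≡ Σ< K (λ k → ΣP m (f k) n)
ΣP-Σ< m zero    f n = ΣP-𝟘 m n
ΣP-Σ< m (suc K) f n = trans (ΣP-+ m (f 0) (λ p → Σ< K (λ k → f (suc k) p)) n) (cong (ΣP m (f 0) n +_) (ΣP-Σ< m K (f ∘ suc) n))

ΣP-unfold : ∀ m w n → ΣP m w (suc n) ≡ Σ< (m ⊓ suc n) (λ i → ΣP (suc i) (w ∘ (suc i ∷_)) (n ∸ i))
ΣP-unfold m w n = begin
  sum (map w (concat (map largest (map suc (upTo K)))))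
    ≡⟨ sum-map-concat w (map largest (map suc (upTo K))) ⟩
  sum (map (λ xs → sum (map w xs)) (map largest (map suc (upTo K))))
    ≡⟨ cong sum (trans (sym (map-∘ (map suc (upTo K)))) (sym (map-∘ (upTo K)))) ⟩
  sum (map (λ i → sum (map w (largest (suc i)))) (upTo K))
    ≡⟨ cong sum (map-upTo _ K) ⟩
  Σ< K (λ i → sum (map w (map (suc i ∷_) (partsF n (n ∸ i) (suc i)))))
    ≡⟨ Σ<-cong K (λ i _ → cong sum (trans (sym (map-∘ (partsF n (n ∸ i) (suc i))))
                                          (cong (map (w ∘ (suc i ∷_))) (partsF-fuel n (n ∸ i) (n ∸ i) (suc i) (m∸n≤m n i) ≤-refl)))) ⟩
  Σ< K (λ i → ΣP (suc i) (w ∘ (suc i ∷_)) (n ∸ i)) ∎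
  where
  open ≡-Reasoning
  K = m ⊓ suc n
  largest : ℕ → List Partition
  largest k = map (k ∷_) (partsF n (suc n ∸ k) k)

ΣP-suc : ∀ m w → ΣP (suc m) w ≗ ΣP m w ⊕ mono (suc m) ⊛ ΣP (suc m) (w ∘ (suc m ∷_))
ΣP-suc m w zero = sym (+-identityʳ (w [] + 0))
ΣP-suc m w (suc n) with m ≤? n
... | yes m≤n = begin
  ΣP (suc m) w (suc n)                        ≡⟨ ΣP-unfold (suc m) w n ⟩
  Σ< (suc m ⊓ suc n) L                        ≡⟨ cong (λ K → Σ< K L) (m≤n⇒m⊓n≡m (s≤s m≤n)) ⟩
  Σ< (suc m) L                                ≡⟨ Σ<-snoc m L ⟩
  Σ< m L + L m                                ≡⟨ cong₂ _+_ (cong (λ K → Σ< K L) (m≤n⇒m⊓n≡m (m≤n⇒m≤1+n m≤n)))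
                                                           (mono-⊛-≥ (suc m) larger (s≤s m≤n)) ⟨
  Σ< (m ⊓ suc n) L + (mono (suc m) ⊛ larger) (suc n)
                                              ≡⟨ cong (_+ (mono (suc m) ⊛ larger) (suc n)) (ΣP-unfold m w n) ⟨
  ΣP m w (suc n) + (mono (suc m) ⊛ larger) (suc n) ∎
  where
  open ≡-Reasoning
  L : ℕ → ℕ
  L i = ΣP (suc i) (w ∘ (suc i ∷_)) (n ∸ i)
  larger = ΣP (suc m) (w ∘ (suc m ∷_))
... | no m≰n = begin
  ΣP (suc m) w (suc n)                        ≡⟨ ΣP-unfold (suc m) w n ⟩
  Σ< (suc m ⊓ suc n) L                        ≡⟨ cong (λ K → Σ< K L) (trans (m≥n⇒m⊓n≡n (m≤n⇒m≤1+n n<m))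
                                                                              (sym (m≥n⇒m⊓n≡n n<m))) ⟩
  Σ< (m ⊓ suc n) L                            ≡⟨ ΣP-unfold m w n ⟨
  ΣP m w (suc n)                              ≡⟨ +-identityʳ _ ⟨
  ΣP m w (suc n) + 0                          ≡⟨ cong (ΣP m w (suc n) +_) (mono-⊛-< (suc m) larger (s<s n<m)) ⟨
  ΣP m w (suc n) + (mono (suc m) ⊛ larger) (suc n) ∎
  where
  open ≡-Reasoning
  n<m = ≰⇒> m≰n
  L : ℕ → ℕ
  L i = ΣP (suc i) (w ∘ (suc i ∷_)) (n ∸ i)
  larger = ΣP (suc m) (w ∘ (suc m ∷_))

ΣP-suc-keep : ∀ m w v → (∀ p → Partition≤ (suc m) p → w (suc m ∷ p) ≡ v p) →
  ΣP (suc m) w ≗ ΣP m w ⊕ mono (suc m) ⊛ ΣP (suc m) v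
ΣP-suc-keep m w v w≡v n =
  trans (ΣP-suc m w n) (cong (ΣP m w n +_) (⊛-congˡ (mono (suc m)) (λ r → ΣP-congᴾ (suc m) r (λ p π _ → w≡v p π)) n))

ΣP-suc-drop : ∀ m w → (∀ p → Partition≤ (suc m) p → w (suc m ∷ p) ≡ 0) → ΣP (suc m) w ≗ ΣP m w
ΣP-suc-drop m w w≡0 n =
  trans (ΣP-suc-keep m w (λ _ → 0) w≡0 n) (trans (cong (ΣP m w n +_) (mono-⊛-𝟘 (suc m) (ΣP-𝟘 (suc m)) n)) (+-identityʳ _))

ΣP-stable : ∀ {m n} w → n ≤ m → ΣP m w n ≡ ΣP n w n
ΣP-stable {m} {n} w n≤m = trans (cong (λ k → ΣP k w n) (sym (m∸n+n≡m n≤m))) (above (m ∸ n))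
  where
  above : ∀ d → ΣP (d + n) w n ≡ ΣP n w n
  above zero    = refl
  above (suc d) = trans (ΣP-suc (d + n) w n)
                        (trans (cong (ΣP (d + n) w n +_) (mono-⊛-< (suc (d + n)) larger (s≤s (m≤n+m n d))))
                               (trans (+-identityʳ _) (above d)))
    where larger = ΣP (suc (d + n)) (w ∘ (suc (d + n) ∷_))

ΣP-largest< : ∀ m w → ΣP (suc m) (λ p → when (largestPart p <ᵇ suc m) (w p)) ≗ ΣP m w
ΣP-largest< m w = ≗-trans (ΣP-suc-drop m w′ (λ p _ → when-false (w (suc m ∷ p)) (<ᵇ-false (≤-refl {suc m}))))
                          (λ n → ΣP-congᴾ m n (λ p π _ → when-true (w p) (<ᵇ-true (s≤s (largestPart≤ π)))))
  where
  w′ = λ p → when (largestPart p <ᵇ suc m) (w p)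

Σ⊢ : (Partition → ℕ) → Series
Σ⊢ w n = ΣP n w n


all≥ᵇ : ℕ → Partition → Bool
all≥ᵇ a []      = true
all≥ᵇ a (k ∷ p) = (a ≤ᵇ k) ∧ all≥ᵇ a p

all≥ᵇ-1 : ∀ {m p} → Partition≤ m p → all≥ᵇ 1 p ≡ true
all≥ᵇ-1 []             = refl
all≥ᵇ-1 (cons 1≤k _ π) = cong₂ _∧_ (≤ᵇ-true 1≤k) (all≥ᵇ-1 π)

_↾≥_ : (Partition → ℕ) → ℕ → Partition → ℕ
(w ↾≥ a) p = when (all≥ᵇ a p) (w p)

↾≥-∷ : ∀ a k w p → (w ↾≥ a) (k ∷ p) ≡ when (a ≤ᵇ k) (((w ∘ (k ∷_)) ↾≥ a) p)
↾≥-∷ a k w p with a ≤ᵇ k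
... | true  = refl
... | false = refl

ΣP-suc-↾≥ : ∀ a m w → a ≤ suc m →
  ΣP (suc m) (w ↾≥ a) ≗ ΣP m (w ↾≥ a) ⊕ mono (suc m) ⊛ ΣP (suc m) ((w ∘ (suc m ∷_)) ↾≥ a)
ΣP-suc-↾≥ a m w a≤1+m = ΣP-suc-keep m (w ↾≥ a) ((w ∘ (suc m ∷_)) ↾≥ a)
                           (λ p _ → trans (↾≥-∷ a (suc m) w p) (when-true _ (≤ᵇ-true a≤1+m)))

ΣP-suc-↾≥-drop : ∀ a m w → suc m < a → ΣP (suc m) (w ↾≥ a) ≗ ΣP m (w ↾≥ a)
ΣP-suc-↾≥-drop a m w m<a = ΣP-suc-drop m (w ↾≥ a) (λ p _ → trans (↾≥-∷ a (suc m) w p) (when-false _ (≤ᵇ-false m<a)))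

∷≡∷ʳ : ∀ {a p} → Partition≤ a p → T (all≥ᵇ a p) → a ∷ p ≡ p ∷ʳ a
∷≡∷ʳ []                         _ = refl
∷≡∷ʳ {a} (cons {k = k} _ k≤a π) t with Equivalence.to T-∧ t
... | a≤ᵇk , rest with ≤-antisym k≤a (≤ᵇ⇒≤ a k a≤ᵇk)
... | refl = cong (a ∷_) (∷≡∷ʳ π rest)

↾≥-∷≡∷ʳ : ∀ a w p → Partition≤ a p → ((w ∘ (a ∷_)) ↾≥ a) p ≡ ((w ∘ (_∷ʳ a)) ↾≥ a) p
↾≥-∷≡∷ʳ a w p π with all≥ᵇ a p in eq
... | false = refl
... | true  = cong w (∷≡∷ʳ π (subst T (sym eq) tt))

-- Either 1 + a is not a part, or it is the smallest part and removing it leaves a partition with parts ≥ 1 + a.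
module SmallestPart (a : ℕ) where
  A A′ B : ℕ → (Partition → ℕ) → Series
  A  m w = ΣP m (w ↾≥ suc a)
  A′ m w = ΣP m (w ↾≥ suc (suc a))
  B  m w = ΣP m ((w ∘ (_∷ʳ suc a)) ↾≥ suc a)

  Split : ℕ → (Partition → ℕ) → ℕ → Set
  Split m w n = A m w n ≡ A′ m w n + when (suc a ≤ᵇ m) ((mono (suc a) ⊛ B m w) n)

  split-below : ∀ m w n → suc a ≤ m → Split m w n → (suc m ≤ n → Split (suc m) (w ∘ (suc m ∷_)) (n ∸ suc m)) →
    Split (suc m) w n
  split-below m w n a≤m split-m split-shorter = begin
    A (suc m) w n
      ≡⟨ ΣP-suc-↾≥ (suc a) m w (m≤n⇒m≤1+n a≤m) n ⟩
    A m w n + (X ⊛ A (suc m) w₁) n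
      ≡⟨ cong₂ _+_ (trans split-m (cong (A′ m w n +_) (when-true _ (≤ᵇ-true a≤m))))
                   (mono-⊛-local (suc m) {A (suc m) w₁} {A′ (suc m) w₁ ⊕ Y ⊛ B (suc m) w₁} n
                      (λ m<n → trans (split-shorter m<n)
                                     (cong (A′ (suc m) w₁ (n ∸ suc m) +_) (when-true _ (≤ᵇ-true (m≤n⇒m≤1+n a≤m)))))) ⟩
    (A′ m w ⊕ Y ⊛ B m w) n + (X ⊛ (A′ (suc m) w₁ ⊕ Y ⊛ B (suc m) w₁)) n
      ≡⟨ solve 6 (λ a₀ b₀ x y a₁ b₁ → (a₀ :+ y :* b₀) :+ x :* (a₁ :+ y :* b₁) := (a₀ :+ x :* a₁) :+ y :* (b₀ :+ x :* b₁))
               ≗-refl (A′ m w) (B m w) X Y (A′ (suc m) w₁) (B (suc m) w₁) n ⟩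
    (A′ m w ⊕ X ⊛ A′ (suc m) w₁) n + (Y ⊛ (B m w ⊕ X ⊛ B (suc m) w₁)) n
      ≡⟨ cong₂ _+_ (ΣP-suc-↾≥ (suc (suc a)) m w (s≤s a≤m) n)
                   (⊛-congˡ Y (ΣP-suc-↾≥ (suc a) m (w ∘ (_∷ʳ suc a)) (m≤n⇒m≤1+n a≤m)) n) ⟨
    A′ (suc m) w n + (Y ⊛ B (suc m) w) n
      ≡⟨ cong (A′ (suc m) w n +_) (when-true _ (≤ᵇ-true (m≤n⇒m≤1+n a≤m))) ⟨
    A′ (suc m) w n + when (suc a ≤ᵇ suc m) ((Y ⊛ B (suc m) w) n) ∎
    where
    open ≡-Reasoning
    open ⊛-Solver
    X = mono (suc m)
    Y = mono (suc a)
    w₁ = w ∘ (suc m ∷_)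

  split-at : ∀ w n → Split a w n → Split (suc a) w n
  split-at w n split-a = begin
    A (suc a) w n
      ≡⟨ ΣP-suc-↾≥ (suc a) a w ≤-refl n ⟩
    A a w n + (Y ⊛ A (suc a) (w ∘ (suc a ∷_))) n
      ≡⟨ cong₂ _+_ (trans split-a (cong (A′ a w n +_) (when-false _ (≤ᵇ-false (n<1+n a)))))
                   (⊛-congˡ Y (λ r → ΣP-congᴾ (suc a) r (λ p π _ → ↾≥-∷≡∷ʳ (suc a) w p π)) n) ⟩
    A′ a w n + 0 + (Y ⊛ B (suc a) w) n
      ≡⟨ cong (_+ (Y ⊛ B (suc a) w) n) (trans (+-identityʳ _) (sym (ΣP-suc-↾≥-drop (suc (suc a)) a w ≤-refl n))) ⟩
    A′ (suc a) w n + (Y ⊛ B (suc a) w) n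
      ≡⟨ cong (A′ (suc a) w n +_) (when-true ((Y ⊛ B (suc a) w) n) (≤ᵇ-true (≤-refl {suc a}))) ⟨
    A′ (suc a) w n + when (suc a ≤ᵇ suc a) ((Y ⊛ B (suc a) w) n) ∎
    where
    open ≡-Reasoning
    Y = mono (suc a)

  split-above : ∀ m w n → suc m < suc a → Split m w n → Split (suc m) w n
  split-above m w n m<a split-m = begin
    A (suc m) w n
      ≡⟨ ΣP-suc-↾≥-drop (suc a) m w m<a n ⟩
    A m w n
      ≡⟨ split-m ⟩
    A′ m w n + when (suc a ≤ᵇ m) ((mono (suc a) ⊛ B m w) n)
      ≡⟨ cong (A′ m w n +_) (when-false _ (≤ᵇ-false (<-trans (n<1+n m) m<a))) ⟩
    A′ m w n + 0
      ≡⟨ cong₂ _+_ (ΣP-suc-↾≥-drop (suc (suc a)) m w (<-trans m<a (n<1+n (suc a))) n)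
                   (when-false ((mono (suc a) ⊛ B (suc m) w) n) (≤ᵇ-false m<a)) ⟨
    A′ (suc m) w n + when (suc a ≤ᵇ suc m) ((mono (suc a) ⊛ B (suc m) w) n) ∎
    where open ≡-Reasoning

  split : ∀ m w n → Acc _<_ n → Split m w n
  split zero    w zero    _        = sym (+-identityʳ _)
  split zero    w (suc n) _        = refl
  split (suc m) w n       (acc rs) with <-cmp (suc a) (suc m)
  ... | tri< a<m _ _  = split-below m w n (≤-pred a<m) (split m w n (acc rs))
                          (λ m<n → split (suc m) (w ∘ (suc m ∷_)) (n ∸ suc m) (rs (∸-monoʳ-< z<s m<n)))
  ... | tri≈ _ refl _ = split-at w n (split a w n (acc rs))
  ... | tri> _ _ m<a  = split-above m w n m<a (split m w n (acc rs))

ΣP-smallest : ∀ a m w n →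
  ΣP m (w ↾≥ suc a) n ≡
  ΣP m (w ↾≥ suc (suc a)) n + when (suc a ≤ᵇ m) ((mono (suc a) ⊛ ΣP m ((w ∘ (_∷ʳ suc a)) ↾≥ suc a)) n)
ΣP-smallest a m w n = SmallestPart.split a m w n (<-wellFounded n)

Σ⊢-smallest : ∀ a w → Σ⊢ (w ↾≥ suc a) ≗ Σ⊢ (w ↾≥ suc (suc a)) ⊕ mono (suc a) ⊛ Σ⊢ ((w ∘ (_∷ʳ suc a)) ↾≥ suc a)
Σ⊢-smallest a w n = trans (ΣP-smallest a n w n) (cong (Σ⊢ (w ↾≥ suc (suc a)) n +_) removed)
  where
  B = (w ∘ (_∷ʳ suc a)) ↾≥ suc a
  removed : when (suc a ≤ᵇ n) ((mono (suc a) ⊛ ΣP n B) n) ≡ (mono (suc a) ⊛ Σ⊢ B) n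
  removed with suc a ≤? n
  ... | yes a<n = trans (when-true _ (≤ᵇ-true a<n))
                        (trans (mono-⊛-≥ (suc a) (ΣP n B) a<n)
                        (trans (ΣP-stable B (m∸n≤m n (suc a))) (sym (mono-⊛-≥ (suc a) (Σ⊢ B) a<n))))
  ... | no  a≮n = trans (when-false _ (≤ᵇ-false (≰⇒> a≮n))) (sym (mono-⊛-< (suc a) (Σ⊢ B) (≰⇒> a≮n)))


-- Hooks of length one

hooksRow-Σ< : ∀ t λs i λi → hooksRow t λs i λi ≡ Σ< λi (λ j → 𝟙 (hook λs i λi (suc j) ≡ᵇ t))
hooksRow-Σ< t λs i λi = trans (length-filter-≟ (hook λs i λi) t (map suc (upTo λi)))
                              (cong sum (trans (sym (map-∘ (upTo λi))) (map-upTo _ λi)))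

conj-∷-≤ : ∀ {j k} p → j ≤ k → conj (k ∷ p) j ≡ suc (conj p j)
conj-∷-≤ p j≤k rewrite ≤ᵇ-true j≤k = refl

conj-∷-> : ∀ {j k} p → k < j → conj (k ∷ p) j ≡ conj p j
conj-∷-> p k<j rewrite ≤ᵇ-false k<j = refl

conj-above : ∀ {b j p} → Partition≤ b p → b < j → conj p j ≡ 0
conj-above []             b<j = refl
conj-above (cons _ c≤b π) b<j = trans (conj-∷-> _ (≤-<-trans c≤b b<j)) (conj-above π (≤-<-trans c≤b b<j))

conj≡0 : ∀ {k p} → Partition≤ (suc k) p → (conj p (suc k) ≡ᵇ 0) ≡ (largestPart p <ᵇ suc k)
conj≡0 []                         = refl
conj≡0 {k} {c ∷ r} (cons _ c≤k π) with m≤n⇒m<n∨m≡n c≤k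
... | inj₁ c<k  = trans (cong (_≡ᵇ 0) (trans (conj-∷-> r c<k) (conj-above π c<k)))
                        (sym (<ᵇ-true c<k))
... | inj₂ refl = trans (cong (_≡ᵇ 0) (conj-∷-≤ r (≤-refl {suc k}))) (sym (<ᵇ-false (≤-refl {suc k})))

hook-∷ : ∀ {j k} p i λi → j ≤ k → hook (k ∷ p) (suc i) λi j ≡ hook p i λi j
hook-∷ {j} p i λi j≤k rewrite conj-∷-≤ p j≤k | +-suc λi (conj p j) = refl

numHooksFrom-∷ : ∀ t k p i {q} → Partition≤ k q → numHooksFrom t (k ∷ p) (suc i) q ≡ numHooksFrom t p i q
numHooksFrom-∷ t k p i []                     = refl
numHooksFrom-∷ t k p i {c ∷ r} (cons _ c≤k π) =
  cong₂ _+_ row (numHooksFrom-∷ t k p (suc i) (Partition≤-mono c≤k π))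
  where
  row : hooksRow t (k ∷ p) (suc i) c ≡ hooksRow t p i c
  row = begin
    hooksRow t (k ∷ p) (suc i) c
      ≡⟨ hooksRow-Σ< t (k ∷ p) (suc i) c ⟩
    Σ< c (λ j → 𝟙 (hook (k ∷ p) (suc i) c (suc j) ≡ᵇ t))
      ≡⟨ Σ<-cong c (λ j j<c → cong (λ h → 𝟙 (h ≡ᵇ t)) (hook-∷ p i c (≤-trans j<c c≤k))) ⟩
    Σ< c (λ j → 𝟙 (hook p i c (suc j) ≡ᵇ t))
      ≡⟨ hooksRow-Σ< t p i c ⟨
    hooksRow t p i c ∎
    where open ≡-Reasoning

-- In the first row, the cell with arm length i has hook length 1 + i + (its leg length).
firstRow-hook : ∀ k p i → i ≤ k → hook (suc k ∷ p) 1 (suc k) (suc (k ∸ i)) ≡ suc (i + conj p (suc (k ∸ i)))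
firstRow-hook k p i i≤k rewrite conj-∷-≤ p (s≤s (m∸n≤m k i)) = begin
  suc k + suc c + 1 ∸ (2 + d)                 ≡⟨ cong (λ x → x ∸ (2 + d)) regroup ⟩
  (2 + d) + suc (i + c) ∸ (2 + d)             ≡⟨ m+n∸m≡n (2 + d) (suc (i + c)) ⟩
  suc (i + c)                                 ∎
  where
  open ≡-Reasoning
  open +-*-Solver
  c = conj p (suc (k ∸ i))
  d = k ∸ i
  regroup : suc k + suc c + 1 ≡ (2 + d) + suc (i + c)
  regroup = begin
    suc k + suc c + 1
      ≡⟨ cong (λ x → suc x + suc c + 1) (m∸n+n≡m i≤k) ⟨
    suc (d + i) + suc c + 1
      ≡⟨ solve 3 (λ d i c → con 1 :+ (d :+ i) :+ (con 1 :+ c) :+ con 1 := con 2 :+ d :+ (con 1 :+ (i :+ c))) refl d i c ⟩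
    (2 + d) + suc (i + c) ∎

firstRow-hooks : ∀ k p → Partition≤ (suc k) p → hooksRow 1 (suc k ∷ p) 1 (suc k) ≡ 𝟙 (largestPart p <ᵇ suc k)
firstRow-hooks k p π = begin
  hooksRow 1 (suc k ∷ p) 1 (suc k)
    ≡⟨ hooksRow-Σ< 1 (suc k ∷ p) 1 (suc k) ⟩
  Σ< (suc k) isOne
    ≡⟨ Σ<-reverse (suc k) isOne ⟩
  Σ< (suc k) (λ i → isOne (k ∸ i))
    ≡⟨ Σ<-cong (suc k) (λ i i≤k → cong (λ h → 𝟙 (h ≡ᵇ 1)) (firstRow-hook k p i (≤-pred i≤k))) ⟩
  𝟙 (conj p (suc k) ≡ᵇ 0) + Σ< k (λ _ → 0)
    ≡⟨ cong₂ _+_ (cong 𝟙 (conj≡0 π)) (Σ<-zero k (λ _ _ → refl)) ⟩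
  𝟙 (largestPart p <ᵇ suc k) + 0
    ≡⟨ +-identityʳ _ ⟩
  𝟙 (largestPart p <ᵇ suc k) ∎
  where
  open ≡-Reasoning
  isOne : ℕ → ℕ
  isOne j = 𝟙 (hook (suc k ∷ p) 1 (suc k) (suc j) ≡ᵇ 1)

numHooks-∷ : ∀ k p → Partition≤ (suc k) p → numHooks 1 (suc k ∷ p) ≡ 𝟙 (largestPart p <ᵇ suc k) + numHooks 1 p
numHooks-∷ k p π = cong₂ _+_ (firstRow-hooks k p π) (numHooksFrom-∷ 1 (suc k) p 1 π)


module PartsIn (s : ℕ → Bool) where

  allIn : Partition → Bool
  allIn []      = true
  allIn (k ∷ p) = s k ∧ allIn p

  countIn hooksIn : Partition → ℕ
  countIn p = 𝟙 (allIn p)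
  hooksIn p = when (allIn p) (numHooks 1 p)

  prodIn sumIn : ℕ → Series
  prodIn zero    = one
  prodIn (suc m) = if s (suc m) then geom (suc m) ⊛ prodIn m else prodIn m
  sumIn  zero    = 𝟘
  sumIn  (suc m) = if s (suc m) then sumIn m ⊕ mono (suc m) else sumIn m

  ΣP-countIn : ∀ m → ΣP m countIn ≗ prodIn m
  ΣP-countIn zero    zero    = refl
  ΣP-countIn zero    (suc n) = refl
  ΣP-countIn (suc m) with s (suc m) in sm
  ... | true  = mono-suc-fixpoint m (λ n → trans (ΣP-suc-keep m countIn countIn (λ p _ → cong (λ b → 𝟙 (b ∧ allIn p)) sm) n)
                                               (cong₂ _+_ (ΣP-countIn m n) refl))
  ... | false = ≗-trans (ΣP-suc-drop m countIn (λ p _ → cong (λ b → 𝟙 (b ∧ allIn p)) sm)) (ΣP-countIn m)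

  hooksIn-∷ : ∀ m {p} → Partition≤ (suc m) p →
    hooksIn (suc m ∷ p) ≡ when (s (suc m)) (when (largestPart p <ᵇ suc m) (countIn p) + hooksIn p)
  hooksIn-∷ m {p} π rewrite numHooks-∷ m p π with s (suc m) | allIn p | largestPart p <ᵇ suc m
  ... | false | _     | _     = refl
  ... | true  | true  | _     = refl
  ... | true  | false | true  = refl
  ... | true  | false | false = refl

  ΣP-hooksIn-step : ∀ m → s (suc m) ≡ true →
    ΣP (suc m) hooksIn ≗ (ΣP m hooksIn ⊕ mono (suc m) ⊛ ΣP m countIn) ⊕ mono (suc m) ⊛ ΣP (suc m) hooksIn
  ΣP-hooksIn-step m sm = begin
    ΣP (suc m) hooksIn
      ≈⟨ ΣP-suc-keep m hooksIn (λ p → new p + hooksIn p) (λ p π → trans (hooksIn-∷ m π) (when-true _ sm)) ⟩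
    ΣP m hooksIn ⊕ X ⊛ ΣP (suc m) (λ p → new p + hooksIn p)
      ≈⟨ (λ n → cong (ΣP m hooksIn n +_) (⊛-congˡ X (≗-trans (ΣP-+ (suc m) new hooksIn)
                                                               (λ r → cong (_+ ΣP (suc m) hooksIn r) (ΣP-largest< m countIn r))) n)) ⟩
    ΣP m hooksIn ⊕ X ⊛ (ΣP m countIn ⊕ ΣP (suc m) hooksIn)
      ≈⟨ solve 4 (λ h x c h′ → h :+ x :* (c :+ h′) := (h :+ x :* c) :+ x :* h′) ≗-refl
               (ΣP m hooksIn) X (ΣP m countIn) (ΣP (suc m) hooksIn) ⟩
    (ΣP m hooksIn ⊕ X ⊛ ΣP m countIn) ⊕ X ⊛ ΣP (suc m) hooksIn ∎
    where
    open ≗-Reasoning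
    open ⊛-Solver
    X = mono (suc m)
    new : Partition → ℕ
    new p = when (largestPart p <ᵇ suc m) (countIn p)

  ΣP-hooksIn : ∀ m → ΣP m hooksIn ≗ prodIn m ⊛ sumIn m
  ΣP-hooksIn zero n = trans (noParts n) (sym (trans (⊛-comm one 𝟘 n) (⊛-zeroˡ one n)))
    where
    noParts : ΣP 0 hooksIn ≗ 𝟘
    noParts zero    = refl
    noParts (suc n) = refl
  ΣP-hooksIn (suc m) with s (suc m) in sm
  ... | true = begin
    ΣP (suc m) hooksIn
      ≈⟨ mono-suc-fixpoint m (ΣP-hooksIn-step m sm) ⟩
    geom (suc m) ⊛ (ΣP m hooksIn ⊕ X ⊛ ΣP m countIn)
      ≈⟨ ⊛-congˡ (geom (suc m)) (λ n → cong₂ _+_ (ΣP-hooksIn m n) (⊛-congˡ X (ΣP-countIn m) n)) ⟩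
    geom (suc m) ⊛ (prodIn m ⊛ sumIn m ⊕ X ⊛ prodIn m)
      ≈⟨ solve 4 (λ g p σ x → g :* (p :* σ :+ x :* p) := (g :* p) :* (σ :+ x)) ≗-refl (geom (suc m)) (prodIn m) (sumIn m) X ⟩
    (geom (suc m) ⊛ prodIn m) ⊛ (sumIn m ⊕ X) ∎
    where
    open ≗-Reasoning
    open ⊛-Solver
    X = mono (suc m)
  ... | false = ≗-trans (ΣP-suc-drop m hooksIn (λ p π → trans (hooksIn-∷ m π) (when-false _ sm))) (ΣP-hooksIn m)

  prodIn-stable : ∀ {m i} → i ≤ m → prodIn m i ≡ prodIn i i
  prodIn-stable {m} {i} i≤m = trans (cong (λ k → prodIn k i) (sym (m∸n+n≡m i≤m))) (above (m ∸ i))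
    where
    above : ∀ d → prodIn (d + i) i ≡ prodIn i i
    above zero = refl
    above (suc d) with s (suc (d + i))
    ... | true  = trans (geom-⊛-≤ (d + i) (prodIn (d + i)) (m≤n+m i d)) (above d)
    ... | false = above d

  sumIn-above : ∀ m {j} → m < j → sumIn m j ≡ 0
  sumIn-above zero    m<j = refl
  sumIn-above (suc m) {j} m<j with s (suc m)
  ... | true  = cong₂ _+_ (sumIn-above m (<-trans (n<1+n m) m<j))
                          (cong 𝟙 (¬T⇒≡false (λ t → <-irrefl (sym (≡ᵇ⇒≡ j (suc m) t)) m<j)))
  ... | false = sumIn-above m (<-trans (n<1+n m) m<j)

  sumIn-coeff : s 0 ≡ false → ∀ m {j} → j ≤ m → sumIn m j ≡ 𝟙 (s j)
  sumIn-coeff s0 zero    z≤n = cong 𝟙 (sym s0)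
  sumIn-coeff s0 (suc m) {j} j≤m with m≤n⇒m<n∨m≡n j≤m | s (suc m) in sm
  ... | inj₁ j<m  | true  = trans (cong₂ _+_ (sumIn-coeff s0 m (≤-pred j<m))
                                             (cong 𝟙 (¬T⇒≡false (λ t → <-irrefl (≡ᵇ⇒≡ j (suc m) t) j<m))))
                                  (+-identityʳ _)
  ... | inj₁ j<m  | false = sumIn-coeff s0 m (≤-pred j<m)
  ... | inj₂ refl | true  = trans (cong₂ _+_ (sumIn-above m (n<1+n m)) (cong 𝟙 (T⇒≡true (≡⇒≡ᵇ m m refl)))) (cong 𝟙 (sym sm))
  ... | inj₂ refl | false = trans (sumIn-above m (n<1+n m)) (cong 𝟙 (sym sm))

  prodIn-skip : ∀ m → s (suc m) ≡ false → prodIn (suc m) ≡ prodIn m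
  prodIn-skip m sm rewrite sm = refl

  prodIn-take : ∀ m → s (suc m) ≡ true → prodIn (suc m) ≡ geom (suc m) ⊛ prodIn m
  prodIn-take m sm rewrite sm = refl


in156mod8 : ℕ → Bool
in156mod8 a = (a % 8 ≡ᵇ 1) ∨ (a % 8 ≡ᵇ 5) ∨ (a % 8 ≡ᵇ 6)

in156mod8-periodic : ∀ r M → in156mod8 (r + 8 * M) ≡ in156mod8 r
in156mod8-periodic r M = cong (λ x → (x ≡ᵇ 1) ∨ (x ≡ᵇ 5) ∨ (x ≡ᵇ 6))
                         (trans (cong (λ y → (r + y) % 8) (*-comm 8 M)) ([m+kn]%n≡m%n r M 8))

open PartsIn in156mod8

cond21≡allIn : ∀ p → cond21 p ≡ allIn p
cond21≡allIn []      = refl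
cond21≡allIn (a ∷ p) = cong (in156mod8 a ∧_) (cond21≡allIn p)

blocks : ℕ → List Series
blocks i = geom (8 * i + 1) ∷ geom (8 * i + 5) ∷ geom (8 * i + 6) ∷ []

prodIn-+8 : ∀ M → prodIn (8 + 8 * M) ≗ geom (6 + 8 * M) ⊛ (geom (5 + 8 * M) ⊛ (geom (1 + 8 * M) ⊛ prodIn (8 * M)))
prodIn-+8 M = begin
  prodIn (8 + B)                                                      ≡⟨ prodIn-skip (7 + B) (in156mod8-periodic 8 M) ⟩
  prodIn (7 + B)                                                      ≡⟨ prodIn-skip (6 + B) (in156mod8-periodic 7 M) ⟩
  prodIn (6 + B)                                                      ≡⟨ prodIn-take (5 + B) (in156mod8-periodic 6 M) ⟩
  geom (6 + B) ⊛ prodIn (5 + B)                                       ≡⟨ cong (geom (6 + B) ⊛_) (prodIn-take (4 + B) (in156mod8-periodic 5 M)) ⟩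
  geom (6 + B) ⊛ (geom (5 + B) ⊛ prodIn (4 + B))                      ≡⟨ cong (λ P → geom (6 + B) ⊛ (geom (5 + B) ⊛ P)) below5 ⟩
  geom (6 + B) ⊛ (geom (5 + B) ⊛ (geom (1 + B) ⊛ prodIn B))           ∎
  where
  open ≗-Reasoning
  B = 8 * M
  below5 : prodIn (4 + B) ≡ geom (1 + B) ⊛ prodIn B
  below5 = trans (prodIn-skip (3 + B) (in156mod8-periodic 4 M)) (trans (prodIn-skip (2 + B) (in156mod8-periodic 3 M))
             (trans (prodIn-skip (1 + B) (in156mod8-periodic 2 M)) (prodIn-take (0 + B) (in156mod8-periodic 1 M))))

prodS-blocks : ∀ M → prodS (concatMap blocks (upTo M)) ≗ prodIn (8 * M)
prodS-blocks zero    = ≗-refl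
prodS-blocks (suc M) = begin
  prodS (concatMap blocks (upTo (suc M)))
    ≡⟨ cong (prodS ∘ concatMap blocks) (upTo-∷ʳ M) ⟨
  prodS (concatMap blocks (upTo M ∷ʳ M))
    ≡⟨ cong prodS (concatMap-++ blocks (upTo M) [ M ]) ⟩
  prodS (concatMap blocks (upTo M) ++ blocks M ++ [])
    ≈⟨ prodS-++ (concatMap blocks (upTo M)) (blocks M ++ []) ⟩
  prodS (concatMap blocks (upTo M)) ⊛ prodS (blocks M)
    ≈⟨ ⊛-cong (prodS-blocks M) (⊛-congˡ a′ (⊛-congˡ b′ (⊛-identityʳ c′))) ⟩
  prodIn B ⊛ (a′ ⊛ (b′ ⊛ c′))
    ≈⟨ solve 4 (λ p a b c → p :* (a :* (b :* c)) := c :* (b :* (a :* p))) ≗-refl (prodIn B) a′ b′ c′ ⟩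
  c′ ⊛ (b′ ⊛ (a′ ⊛ prodIn B))
    ≡⟨ cong₂ (λ x y → geom x ⊛ (geom y ⊛ (a′ ⊛ prodIn B))) (+-comm B 6) (+-comm B 5) ⟩
  geom (6 + B) ⊛ (geom (5 + B) ⊛ (a′ ⊛ prodIn B))
    ≡⟨ cong (λ x → geom (6 + B) ⊛ (geom (5 + B) ⊛ (geom x ⊛ prodIn B))) (+-comm B 1) ⟩
  geom (6 + B) ⊛ (geom (5 + B) ⊛ (geom (1 + B) ⊛ prodIn B))
    ≈⟨ prodIn-+8 M ⟨
  prodIn (8 + B)
    ≡⟨ cong prodIn (*-suc 8 M) ⟨
  prodIn (8 * suc M) ∎
  where
  open ≗-Reasoning
  open ⊛-Solver
  B = 8 * M
  a′ = geom (B + 1)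
  b′ = geom (B + 5)
  c′ = geom (B + 6)

invProd1568-coeff : ∀ {n i} → i ≤ n → prodIn n i ≡ invProd1568 i
invProd1568-coeff {n} {i} i≤n = begin
  prodIn n i                                       ≡⟨ prodIn-stable i≤n ⟩
  prodIn i i                                       ≡⟨ prodIn-stable (≤-trans (m≤m+n i (7 * suc i)) (n≤1+n _)) ⟨
  prodIn (8 * suc i) i                             ≡⟨ prodS-blocks (suc i) i ⟨
  invProd1568 i                                    ∎
  where open ≡-Reasoning

residues156 : Series
residues156 = mono 1 ⊕ mono 5 ⊕ mono 6

geom8-⊛-residues156 : ∀ j → (geom 8 ⊛ residues156) j ≡ 𝟙 (in156mod8 j)
geom8-⊛-residues156 0 = geom-⊛-≤ 7 residues156 (≤ᵇ⇒≤ 0 7 tt)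
geom8-⊛-residues156 1 = geom-⊛-≤ 7 residues156 (≤ᵇ⇒≤ 1 7 tt)
geom8-⊛-residues156 2 = geom-⊛-≤ 7 residues156 (≤ᵇ⇒≤ 2 7 tt)
geom8-⊛-residues156 3 = geom-⊛-≤ 7 residues156 (≤ᵇ⇒≤ 3 7 tt)
geom8-⊛-residues156 4 = geom-⊛-≤ 7 residues156 (≤ᵇ⇒≤ 4 7 tt)
geom8-⊛-residues156 5 = geom-⊛-≤ 7 residues156 (≤ᵇ⇒≤ 5 7 tt)
geom8-⊛-residues156 6 = geom-⊛-≤ 7 residues156 (≤ᵇ⇒≤ 6 7 tt)
geom8-⊛-residues156 7 = geom-⊛-≤ 7 residues156 (≤ᵇ⇒≤ 7 7 tt)
geom8-⊛-residues156 (suc (suc (suc (suc (suc (suc (suc (suc j)))))))) = begin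
  (geom 8 ⊛ residues156) (8 + j)                        ≡⟨ geom-⊛-unfold 7 residues156 (8 + j) ⟩
  0 + (mono 8 ⊛ (geom 8 ⊛ residues156)) (8 + j)         ≡⟨ mono-⊛-+ 8 (geom 8 ⊛ residues156) j ⟩
  (geom 8 ⊛ residues156) j                              ≡⟨ geom8-⊛-residues156 j ⟩
  𝟙 (in156mod8 j)                                       ≡⟨ cong 𝟙 (trans (cong in156mod8 (+-comm 8 j)) (in156mod8-periodic j 1)) ⟨
  𝟙 (in156mod8 (8 + j))                                 ∎
  where open ≡-Reasoning


-- The gap condition

gap : ℕ → ℕ
gap c = if odd? c then 3 else 2

gap≥2 : ∀ c → 2 ≤ gap c
gap≥2 c with odd? c
... | true  = s≤s (s≤s z≤n)
... | false = ≤-refl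

odd?-+2 : ∀ c → odd? (c + 2) ≡ odd? c
odd?-+2 c = cong (_≡ᵇ 1) ([m+n]%n≡m%n c 2)

gap-+2 : ∀ c → gap (suc (suc c)) ≡ gap c
gap-+2 c = cong (λ b → if b then 3 else 2) (trans (cong odd? (+-comm 2 c)) (odd?-+2 c))

gap-condition-+ : ∀ c d → (2 ≤ᵇ d) ∧ (not (odd? (c + d)) ∨ (2 <ᵇ d)) ≡ (gap c ≤ᵇ d)
gap-condition-+ c 0 with odd? c
... | true  = refl
... | false = refl
gap-condition-+ c 1 with odd? c
... | true  = refl
... | false = refl
gap-condition-+ c 2 rewrite odd?-+2 c with odd? c
... | true  = refl
... | false = refl
gap-condition-+ c (suc (suc (suc e))) rewrite ∨-zeroʳ (not (odd? (c + suc (suc (suc e))))) with odd? c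
... | true  = refl
... | false = refl

-- cond11 asks for a difference above 2 when the larger part j is odd; since j - c = 2 forces j and c to have
-- the same parity, this is the same as j ≥ c + gap c, stated with the smaller part c.
gap-condition : ∀ j c → (2 ≤ᵇ j ∸ c) ∧ (not (odd? j) ∨ (2 <ᵇ j ∸ c)) ≡ (c + gap c ≤ᵇ j)
gap-condition j c with c ≤? j
... | no c≰j rewrite m≤n⇒m∸n≡0 (<⇒≤ (≰⇒> c≰j)) = sym (≤ᵇ-false (<-≤-trans (≰⇒> c≰j) (m≤m+n c (gap c))))
... | yes c≤j = begin
  (2 ≤ᵇ j ∸ c) ∧ (not (odd? j) ∨ (2 <ᵇ j ∸ c))
    ≡⟨ cong (λ x → (2 ≤ᵇ j ∸ c) ∧ (not (odd? x) ∨ (2 <ᵇ j ∸ c))) (m+[n∸m]≡n c≤j) ⟨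
  (2 ≤ᵇ j ∸ c) ∧ (not (odd? (c + (j ∸ c))) ∨ (2 <ᵇ j ∸ c))
    ≡⟨ gap-condition-+ c (j ∸ c) ⟩
  (gap c ≤ᵇ j ∸ c)
    ≡⟨ ≤ᵇ-cong (λ g≤d → subst (c + gap c ≤_) (m+[n∸m]≡n c≤j) (+-monoʳ-≤ c g≤d))
               (λ c+g≤j → +-cancelˡ-≤ c _ _ (subst (c + gap c ≤_) (sym (m+[n∸m]≡n c≤j)) c+g≤j)) ⟩
  (c + gap c ≤ᵇ j)                                          ∎
  where open ≡-Reasoning

cond11-∷∷ : ∀ j c r → cond11 (j ∷ c ∷ r) ≡ (c + gap c ≤ᵇ j) ∧ cond11 (c ∷ r)
cond11-∷∷ j c r = trans (sym (∧-assoc (2 ≤ᵇ j ∸ c) _ _)) (cong (_∧ cond11 (c ∷ r)) (gap-condition j c))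

cond11-∷ʳ : ∀ a p → all≥ᵇ a p ∧ cond11 (p ∷ʳ a) ≡ all≥ᵇ (a + gap a) p ∧ cond11 p
cond11-∷ʳ a []          = refl
cond11-∷ʳ a (j ∷ [])    = begin
  ((a ≤ᵇ j) ∧ true) ∧ cond11 (j ∷ a ∷ [])
    ≡⟨ cong₂ _∧_ (∧-identityʳ (a ≤ᵇ j)) (cond11-∷∷ j a []) ⟩
  (a ≤ᵇ j) ∧ ((a + gap a ≤ᵇ j) ∧ true)
    ≡⟨ ∧-congˡ-under ((a + gap a ≤ᵇ j) ∧ true)
                     (λ t → ≤ᵇ-true (≤-trans (m≤m+n a (gap a)) (≤ᵇ⇒≤ _ _ (proj₁ (Equivalence.to T-∧ t))))) ⟩
  true ∧ ((a + gap a ≤ᵇ j) ∧ true)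
    ≡⟨ cong (_∧ true) (sym (∧-identityʳ _)) ⟩
  ((a + gap a ≤ᵇ j) ∧ true) ∧ true ∎
  where open ≡-Reasoning
cond11-∷ʳ a (j ∷ c ∷ r) = begin
  ((a ≤ᵇ j) ∧ R) ∧ cond11 (j ∷ c ∷ r ∷ʳ a)
    ≡⟨ cong (((a ≤ᵇ j) ∧ R) ∧_) (cond11-∷∷ j c (r ∷ʳ a)) ⟩
  ((a ≤ᵇ j) ∧ R) ∧ (X ∧ C)
    ≡⟨ ∧-interchange (a ≤ᵇ j) R X C ⟩
  ((a ≤ᵇ j) ∧ X) ∧ (R ∧ C)
    ≡⟨ cong (((a ≤ᵇ j) ∧ X) ∧_) (cond11-∷ʳ a (c ∷ r)) ⟩
  ((a ≤ᵇ j) ∧ X) ∧ (R′ ∧ C′)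
    ≡⟨ ∧-assoc (a ≤ᵇ j) X _ ⟩
  (a ≤ᵇ j) ∧ (X ∧ (R′ ∧ C′))
    ≡⟨ ∧-congˡ-under (X ∧ (R′ ∧ C′))
                     (λ t → trans (≤ᵇ-true (≤-trans (m≤m+n a (gap a)) (a+g≤j t))) (sym (≤ᵇ-true (a+g≤j t)))) ⟩
  (a + gap a ≤ᵇ j) ∧ (X ∧ (R′ ∧ C′))
    ≡⟨ ∧-assoc (a + gap a ≤ᵇ j) X _ ⟨
  ((a + gap a ≤ᵇ j) ∧ X) ∧ (R′ ∧ C′)
    ≡⟨ ∧-interchange (a + gap a ≤ᵇ j) X R′ C′ ⟩
  ((a + gap a ≤ᵇ j) ∧ R′) ∧ (X ∧ C′)
    ≡⟨ cong (((a + gap a ≤ᵇ j) ∧ R′) ∧_) (cond11-∷∷ j c r) ⟨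
  ((a + gap a ≤ᵇ j) ∧ R′) ∧ cond11 (j ∷ c ∷ r) ∎
  where
  open ≡-Reasoning
  X = c + gap c ≤ᵇ j
  R = all≥ᵇ a (c ∷ r)
  C = cond11 ((c ∷ r) ∷ʳ a)
  R′ = all≥ᵇ (a + gap a) (c ∷ r)
  C′ = cond11 (c ∷ r)
  a+g≤j : T (X ∧ (R′ ∧ C′)) → a + gap a ≤ j
  a+g≤j t with Equivalence.to T-∧ t
  ... | tX , tRC = ≤-trans (≤ᵇ⇒≤ _ _ (proj₁ (Equivalence.to T-∧ (proj₁ (Equivalence.to T-∧ tRC)))))
                           (≤-trans (m≤m+n c (gap c)) (≤ᵇ⇒≤ _ _ tX))

numHooks-cond11 : ∀ {m p} → Partition≤ m p → T (cond11 p) → numHooks 1 p ≡ length p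
numHooks-cond11 []                             _ = refl
numHooks-cond11 {p = suc k ∷ q} (cons _ _ π) t = begin
  numHooks 1 (suc k ∷ q)                       ≡⟨ numHooks-∷ k q π ⟩
  𝟙 (largestPart q <ᵇ suc k) + numHooks 1 q    ≡⟨ cong₂ _+_ (cong 𝟙 (<ᵇ-true (below q π t))) (numHooks-cond11 π (tail q t)) ⟩
  suc (length q)                               ∎
  where
  open ≡-Reasoning
  below : ∀ q → Partition≤ (suc k) q → T (cond11 (suc k ∷ q)) → largestPart q < suc k
  below []      _ _ = z<s
  below (c ∷ r) _ t = <-≤-trans (m<m+n c (≤-trans (s≤s z≤n) (gap≥2 c)))
                                (≤ᵇ⇒≤ _ _ (proj₁ (Equivalence.to T-∧ (subst T (cond11-∷∷ (suc k) c r) t))))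
  tail : ∀ q → T (cond11 (suc k ∷ q)) → T (cond11 q)
  tail []      _ = tt
  tail (c ∷ r) t = proj₂ (Equivalence.to T-∧ (subst T (cond11-∷∷ (suc k) c r) t))


-- F a k stands for the generating function of cond11 partitions into k parts, all ≥ a.
record GapRecursion (F : ℕ → ℕ → Series) : Set where
  field
    no-parts  : ∀ a → F a 0 ≗ one
    too-small : ∀ a k {n} → n ≤ a → F (suc a) (suc k) n ≡ 0
    smallest  : ∀ a k → F (suc a) (suc k) ≗ F (suc (suc a)) (suc k) ⊕ mono (suc a) ⊛ F (suc a + gap (suc a)) k

gapRecursion-unique : ∀ {F G} → GapRecursion F → GapRecursion G → ∀ a k → F (suc a) k ≗ G (suc a) k
gapRecursion-unique {F} {G} recF recG a k n = agree n (<-wellFounded n) a k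
  where
  module F = GapRecursion recF
  module G = GapRecursion recG
  agree : ∀ n → Acc _<_ n → ∀ a k → F (suc a) k n ≡ G (suc a) k n
  agree n _        a zero    = trans (F.no-parts (suc a) n) (sym (G.no-parts (suc a) n))
  agree n (acc rs) a (suc k) = descend n a (s≤s (m≤n+m n a))
    where
    -- downward induction on a, starting from a ≥ n where both sides vanish
    descend : ∀ d a → n < suc a + d → F (suc a) (suc k) n ≡ G (suc a) (suc k) n
    descend zero    a n<a+0 = trans (F.too-small a k n≤a) (sym (G.too-small a k n≤a))
      where n≤a = ≤-pred (subst (n <_) (cong suc (+-identityʳ a)) n<a+0)
    descend (suc d) a n<a+d = begin
      F (suc a) (suc k) n
        ≡⟨ F.smallest a k n ⟩
      F (suc (suc a)) (suc k) n + (mono (suc a) ⊛ F (suc a + gap (suc a)) k) n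
        ≡⟨ cong₂ _+_ (descend d (suc a) (subst (n <_) (cong suc (+-suc a d)) n<a+d))
                     (mono-⊛-local (suc a) {F (suc a + gap (suc a)) k} {G (suc a + gap (suc a)) k} n
                        (λ a<n → agree (n ∸ suc a) (rs (∸-monoʳ-< z<s a<n)) (a + gap (suc a)) k)) ⟩
      G (suc (suc a)) (suc k) n + (mono (suc a) ⊛ G (suc a + gap (suc a)) k) n
        ≡⟨ G.smallest a k n ⟨
      G (suc a) (suc k) n ∎
      where open ≡-Reasoning

gapWeight : ℕ → Partition → ℕ
gapWeight k p = 𝟙 (cond11 p ∧ (length p ≡ᵇ k))

gapCount : ℕ → ℕ → Series
gapCount a k = Σ⊢ (gapWeight k ↾≥ a)

gapWeight-∷ʳ : ∀ a k p → ((gapWeight (suc k) ∘ (_∷ʳ a)) ↾≥ a) p ≡ (gapWeight k ↾≥ (a + gap a)) p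
gapWeight-∷ʳ a k p = begin
  when (all≥ᵇ a p) (𝟙 (cond11 (p ∷ʳ a) ∧ (length (p ∷ʳ a) ≡ᵇ suc k)))
    ≡⟨ cong (λ l → when (all≥ᵇ a p) (𝟙 (cond11 (p ∷ʳ a) ∧ (l ≡ᵇ suc k))))
                (trans (length-++ p) (+-comm (length p) 1)) ⟩
  when (all≥ᵇ a p) (𝟙 (cond11 (p ∷ʳ a) ∧ (length p ≡ᵇ k)))
    ≡⟨ when-𝟙 (all≥ᵇ a p) _ ⟩
  𝟙 (all≥ᵇ a p ∧ (cond11 (p ∷ʳ a) ∧ (length p ≡ᵇ k)))
    ≡⟨ cong 𝟙 (trans (sym (∧-assoc (all≥ᵇ a p) _ _))
      (trans (cong (_∧ (length p ≡ᵇ k)) (cond11-∷ʳ a p)) (∧-assoc (all≥ᵇ (a + gap a) p) (cond11 p) _))) ⟩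
  𝟙 (all≥ᵇ (a + gap a) p ∧ (cond11 p ∧ (length p ≡ᵇ k)))
    ≡⟨ when-𝟙 (all≥ᵇ (a + gap a) p) _ ⟨
  when (all≥ᵇ (a + gap a) p) (𝟙 (cond11 p ∧ (length p ≡ᵇ k))) ∎
  where open ≡-Reasoning

gapCount-recursion : GapRecursion gapCount
gapCount-recursion = record
  { no-parts  = no-parts
  ; too-small = too-small
  ; smallest  = λ a k → ≗-trans (Σ⊢-smallest a (gapWeight (suc k)))
                          (λ n → cong (gapCount (suc (suc a)) (suc k) n +_)
                                      (⊛-congˡ (mono (suc a)) (λ r → ΣP-cong r (gapWeight-∷ʳ (suc a) k) r) n))
  }
  where
  no-parts : ∀ a → gapCount a 0 ≗ one
  no-parts a zero    = refl
  no-parts a (suc n) = trans (ΣP-congᴾ (suc n) (suc n) nonempty) (ΣP-𝟘 (suc n) (suc n))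
    where
    nonempty : ∀ p → Partition≤ (suc n) p → sum p ≡ suc n → (gapWeight 0 ↾≥ a) p ≡ 0
    nonempty (k ∷ q) _ _ = trans (cong (λ b → when (all≥ᵇ a (k ∷ q)) (𝟙 b)) (∧-zeroʳ (cond11 (k ∷ q)))) (when-0 _)
  too-small : ∀ a k {n} → n ≤ a → gapCount (suc a) (suc k) n ≡ 0
  too-small a k {n} n≤a = trans (ΣP-congᴾ n n tooLarge) (ΣP-𝟘 n n)
    where
    tooLarge : ∀ p → Partition≤ n p → sum p ≡ n → (gapWeight (suc k) ↾≥ suc a) p ≡ 0
    tooLarge []      _ _  = refl
    tooLarge (c ∷ q) _ Σp = when-false _ (cong (_∧ all≥ᵇ (suc a) q)
                              (≤ᵇ-false (s≤s (≤-trans (subst (c ≤_) Σp (m≤m+n c (sum q))) n≤a))))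


-- Closed forms

-- q^k (-q^{-1}; q²)_k,  (-q; q²)_k  and  1 / (q²; q²)_k
negQ oddQ invQ2 : ℕ → Series
negQ  k = prodS (map (λ i → mono 1 ⊕ mono (2 * i)) (upTo k))
oddQ  k = prodS (map (λ i → one ⊕ mono (2 * i + 1)) (upTo k))
invQ2 k = prodS (map (λ i → geom (2 * suc i)) (upTo k))

negQ-suc : ∀ k → negQ (suc k) ≗ (one ⊕ mono 1) ⊛ (mono k ⊛ oddQ k)
negQ-suc k = ⊛-cong (λ n → +-comm (mono 1 n) (one n)) (begin
  prodS (map (λ i → mono 1 ⊕ mono (2 * i)) (applyUpTo suc k))
    ≡⟨ cong prodS (map-applyUpTo suc _ k) ⟩
  prodS (applyUpTo (λ i → mono 1 ⊕ mono (2 * suc i)) k)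
    ≈⟨ prodS-applyUpTo-mono1 k shifted ⟩
  mono k ⊛ prodS (applyUpTo (λ i → one ⊕ mono (2 * i + 1)) k)
    ≡⟨ cong (λ P → mono k ⊛ prodS P) (map-upTo (λ i → one ⊕ mono (2 * i + 1)) k) ⟨
  mono k ⊛ oddQ k ∎)
  where
  open ≗-Reasoning
  shifted : ∀ i → mono 1 ⊕ mono (2 * suc i) ≗ mono 1 ⊛ (one ⊕ mono (2 * i + 1))
  shifted i = ≗-sym (begin
    mono 1 ⊛ (one ⊕ mono (2 * i + 1))
      ≈⟨ ≗-trans (⊛-comm (mono 1) (one ⊕ mono (2 * i + 1))) (⊛-distribʳ (mono 1) one (mono (2 * i + 1))) ⟩
    one ⊛ mono 1 ⊕ mono (2 * i + 1) ⊛ mono 1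
      ≈⟨ (λ n → cong₂ _+_ (⊛-identityˡ (mono 1) n) (trans (sym (mono-+ (2 * i + 1) 1 n)) (cong (λ e → mono e n) (twice-suc i)))) ⟩
    mono 1 ⊕ mono (2 * suc i) ∎)
    where
    twice-suc : ∀ i → 2 * i + 1 + 1 ≡ 2 * suc i
    twice-suc i = solve 1 (λ i → con 2 :* i :+ con 1 :+ con 1 := con 2 :* (con 1 :+ i)) refl i
      where open +-*-Solver

closed₁ closed₂ : ℕ → Series
closed₁ k = mono (k * k) ⊛ (negQ k ⊛ invQ2 k)
closed₂ k = mono (k * k + k) ⊛ (oddQ k ⊛ invQ2 k)

-- With Q = q^{(k+1)² + k}, E = (-q; q²)_k / (q²; q²)_k and Γ = E / (1 - q^{2k+2}), both closed forms for k + 1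
-- parts are Q (1 + q) Γ and q Q (1 + q^{2k+1}) Γ, and Γ = E + q^{2k+2} Γ gives the two recursions.
module ClosedForms (k : ℕ) where
  x y Q E Γ : Series
  x = mono 1
  y = mono (2 * k + 1)
  Q = mono (suc k * suc k + k)
  E = oddQ k ⊛ invQ2 k
  Γ = geom (2 * suc k) ⊛ E

  x⊛y : x ⊛ y ≗ mono (suc k + suc k)
  x⊛y = ≗-trans (≗-sym (mono-+ 1 (2 * k + 1))) (mono-cong exponent)
    where
    open +-*-Solver
    exponent : 1 + (2 * k + 1) ≡ suc k + suc k
    exponent = solve 1 (λ k → con 1 :+ (con 2 :* k :+ con 1) := (con 1 :+ k) :+ (con 1 :+ k)) refl k

  Γ-unfold : Γ ≗ E ⊕ (x ⊛ y) ⊛ Γ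
  Γ-unfold n = trans (geom-⊛-unfold (k + suc (k + 0)) E n)
                     (cong (E n +_) (⊛-congʳ Γ (≗-trans (mono-cong exponent) (≗-sym x⊛y)) n))
    where
    open +-*-Solver
    exponent : 2 * suc k ≡ suc k + suc k
    exponent = solve 1 (λ k → con 2 :* (con 1 :+ k) := (con 1 :+ k) :+ (con 1 :+ k)) refl k

  closed₁-suc : closed₁ (suc k) ≗ Q ⊛ ((one ⊕ x) ⊛ Γ)
  closed₁-suc = begin
    mono (suc k * suc k) ⊛ (negQ (suc k) ⊛ invQ2 (suc k))
      ≈⟨ ⊛-congˡ (mono (suc k * suc k)) (⊛-cong (negQ-suc k) (prodS-map-upTo-suc (λ i → geom (2 * suc i)) k)) ⟩
    mono (suc k * suc k) ⊛ (((one ⊕ x) ⊛ (mono k ⊛ oddQ k)) ⊛ (invQ2 k ⊛ geom (2 * suc k)))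
      ≈⟨ solve 6 (λ m o k p i g → m :* ((o :* (k :* p)) :* (i :* g)) := (m :* k) :* (o :* (g :* (p :* i)))) ≗-refl
               (mono (suc k * suc k)) (one ⊕ x) (mono k) (oddQ k) (invQ2 k) (geom (2 * suc k)) ⟩
    (mono (suc k * suc k) ⊛ mono k) ⊛ ((one ⊕ x) ⊛ Γ)
      ≈⟨ ⊛-congʳ ((one ⊕ x) ⊛ Γ) (≗-sym (mono-+ (suc k * suc k) k)) ⟩
    Q ⊛ ((one ⊕ x) ⊛ Γ) ∎
    where
    open ≗-Reasoning
    open ⊛-Solver

  closed₂-suc : closed₂ (suc k) ≗ (Q ⊛ x) ⊛ ((one ⊕ y) ⊛ Γ)
  closed₂-suc = begin
    mono (suc k * suc k + suc k) ⊛ (oddQ (suc k) ⊛ invQ2 (suc k))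
      ≈⟨ ⊛-congˡ (mono (suc k * suc k + suc k)) (⊛-cong (prodS-map-upTo-suc (λ i → one ⊕ mono (2 * i + 1)) k)
                                                        (prodS-map-upTo-suc (λ i → geom (2 * suc i)) k)) ⟩
    mono (suc k * suc k + suc k) ⊛ ((oddQ k ⊛ (one ⊕ y)) ⊛ (invQ2 k ⊛ geom (2 * suc k)))
      ≈⟨ solve 5 (λ m p o i g → m :* ((p :* o) :* (i :* g)) := m :* (o :* (g :* (p :* i)))) ≗-refl
               (mono (suc k * suc k + suc k)) (oddQ k) (one ⊕ y) (invQ2 k) (geom (2 * suc k)) ⟩
    mono (suc k * suc k + suc k) ⊛ ((one ⊕ y) ⊛ Γ)
      ≈⟨ ⊛-congʳ ((one ⊕ y) ⊛ Γ) (≗-trans (mono-cong (trans (+-suc (suc k * suc k) k) (+-comm 1 (suc k * suc k + k))))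
                                           (mono-+ (suc k * suc k + k) 1)) ⟩
    (Q ⊛ x) ⊛ ((one ⊕ y) ⊛ Γ) ∎
    where
    open ≗-Reasoning
    open ⊛-Solver

  closed₂-shift : x ⊛ (mono (k + k) ⊛ closed₂ k) ≗ Q ⊛ E
  closed₂-shift = ≗-trans (⊛-congˡ x (mono-⊛-mono (k + k) (k * k + k) E))
                  (≗-trans (mono-⊛-mono 1 (k + k + (k * k + k)) E) (⊛-congʳ E (mono-cong exponent)))
    where
    open +-*-Solver
    exponent : 1 + (k + k + (k * k + k)) ≡ suc k * suc k + k
    exponent = solve 1 (λ k → con 1 :+ (k :+ k :+ (k :* k :+ k)) := (con 1 :+ k) :* (con 1 :+ k) :+ k) refl k

  closed₁-smallest : closed₁ (suc k) ≗ closed₂ (suc k) ⊕ x ⊛ (mono (k + k) ⊛ closed₂ k)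
  closed₁-smallest = begin
    closed₁ (suc k)
      ≈⟨ closed₁-suc ⟩
    Q ⊛ ((one ⊕ x) ⊛ Γ)
      ≈⟨ solve 3 (λ q x g → q :* ((con 1 :+ x) :* g) := q :* g :+ (q :* x) :* g) ≗-refl Q x Γ ⟩
    Q ⊛ Γ ⊕ (Q ⊛ x) ⊛ Γ
      ≈⟨ (λ n → cong (_+ ((Q ⊛ x) ⊛ Γ) n) (⊛-congˡ Q Γ-unfold n)) ⟩
    Q ⊛ (E ⊕ (x ⊛ y) ⊛ Γ) ⊕ (Q ⊛ x) ⊛ Γ
      ≈⟨ solve 5 (λ q x y e g → q :* (e :+ (x :* y) :* g) :+ (q :* x) :* g := (q :* x) :* ((con 1 :+ y) :* g) :+ q :* e)
               ≗-refl Q x y E Γ ⟩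
    (Q ⊛ x) ⊛ ((one ⊕ y) ⊛ Γ) ⊕ Q ⊛ E
      ≈⟨ (λ n → sym (cong₂ _+_ (closed₂-suc n) (closed₂-shift n))) ⟩
    closed₂ (suc k) ⊕ x ⊛ (mono (k + k) ⊛ closed₂ k) ∎
    where
    open ≗-Reasoning
    open ⊛-Solver

  closed₂-smallest : closed₂ (suc k) ≗ mono (suc k + suc k) ⊛ closed₁ (suc k) ⊕ mono 2 ⊛ (mono (k + k) ⊛ closed₂ k)
  closed₂-smallest = begin
    closed₂ (suc k)
      ≈⟨ closed₂-suc ⟩
    (Q ⊛ x) ⊛ ((one ⊕ y) ⊛ Γ)
      ≈⟨ solve 4 (λ q x y g → (q :* x) :* ((con 1 :+ y) :* g) := (q :* x) :* g :+ (q :* x :* y) :* g) ≗-refl Q x y Γ ⟩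
    (Q ⊛ x) ⊛ Γ ⊕ (Q ⊛ x ⊛ y) ⊛ Γ
      ≈⟨ (λ n → cong (_+ ((Q ⊛ x ⊛ y) ⊛ Γ) n) (⊛-congˡ (Q ⊛ x) Γ-unfold n)) ⟩
    (Q ⊛ x) ⊛ (E ⊕ (x ⊛ y) ⊛ Γ) ⊕ (Q ⊛ x ⊛ y) ⊛ Γ
      ≈⟨ solve 5 (λ q x y e g → (q :* x) :* (e :+ (x :* y) :* g) :+ (q :* x :* y) :* g
                   := (x :* y) :* (q :* ((con 1 :+ x) :* g)) :+ x :* (q :* e))
               ≗-refl Q x y E Γ ⟩
    (x ⊛ y) ⊛ (Q ⊛ ((one ⊕ x) ⊛ Γ)) ⊕ x ⊛ (Q ⊛ E)
      ≈⟨ (λ n → cong₂ _+_ (⊛-cong x⊛y (≗-sym closed₁-suc) n)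
                           (sym (trans (⊛-congʳ (mono (k + k) ⊛ closed₂ k) (mono-+ 1 1) n)
                                (trans (⊛-assoc x x (mono (k + k) ⊛ closed₂ k) n) (⊛-congˡ x closed₂-shift n))))) ⟩
    mono (suc k + suc k) ⊛ closed₁ (suc k) ⊕ mono 2 ⊛ (mono (k + k) ⊛ closed₂ k) ∎
    where
    open ≗-Reasoning
    open ⊛-Solver

-- The claimed generating functions for GapRecursion; index 0 repeats index 1.
closed : ℕ → ℕ → Series
closed 0                   = closed₁
closed 1                   = closed₁
closed 2                   = closed₂
closed (suc (suc (suc a))) k = mono (k + k) ⊛ closed (suc a) k

closed-recursion : GapRecursion closed
closed-recursion = record { no-parts = no-parts ; too-small = too-small ; smallest = smallest }
  where
  one⊛one⊛one : one ⊛ (one ⊛ one) ≗ one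
  one⊛one⊛one = ≗-trans (⊛-identityˡ (one ⊛ one)) (⊛-identityˡ one)

  no-parts : ∀ a → closed a 0 ≗ one
  no-parts 0                   = one⊛one⊛one
  no-parts 1                   = one⊛one⊛one
  no-parts 2                   = one⊛one⊛one
  no-parts (suc (suc (suc a))) = ≗-trans (⊛-identityˡ (closed (suc a) 0)) (no-parts (suc a))

  too-small : ∀ a k {n} → n ≤ a → closed (suc a) (suc k) n ≡ 0
  too-small 0             k z≤n = mono-⊛-< (suc k * suc k) (negQ (suc k) ⊛ invQ2 (suc k)) z<s
  too-small 1             k n≤1 = mono-⊛-< (suc k * suc k + suc k) (oddQ (suc k) ⊛ invQ2 (suc k))
                                            (≤-trans (s≤s n≤1) (+-mono-≤ {1} {suc k * suc k} (s≤s z≤n) (s≤s z≤n)))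
  too-small (suc (suc a)) k {n} n≤a = trans (mono-⊛-local (suc k + suc k) {closed (suc a) (suc k)} {𝟘} n vanish)
                                            (mono-⊛-𝟘 (suc k + suc k) {𝟘} (λ _ → refl) n)
    where
    vanish : suc k + suc k ≤ n → closed (suc a) (suc k) (n ∸ (suc k + suc k)) ≡ 0
    vanish _ = too-small a k (≤-trans (∸-monoʳ-≤ n (+-mono-≤ {1} {suc k} (s≤s z≤n) (s≤s z≤n))) (∸-monoˡ-≤ 2 n≤a))

  smallest : ∀ a k → closed (suc a) (suc k) ≗ closed (suc (suc a)) (suc k) ⊕ mono (suc a) ⊛ closed (suc a + gap (suc a)) k
  smallest 0             k = ClosedForms.closed₁-smallest k
  smallest 1             k = ClosedForms.closed₂-smallest k
  smallest (suc (suc a)) k = begin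
    mono S ⊛ closed (suc a) (suc k)
      ≈⟨ ⊛-congˡ (mono S) (smallest a k) ⟩
    mono S ⊛ (closed (suc (suc a)) (suc k) ⊕ mono (suc a) ⊛ closed (suc a + gap (suc a)) k)
      ≈⟨ ⊛-distribˡ (mono S) (closed (suc (suc a)) (suc k)) (mono (suc a) ⊛ closed (suc a + gap (suc a)) k) ⟩
    mono S ⊛ closed (suc (suc a)) (suc k) ⊕ mono S ⊛ (mono (suc a) ⊛ closed (suc a + gap (suc a)) k)
      ≈⟨ (λ n → cong ((mono S ⊛ closed (suc (suc a)) (suc k)) n +_)
                     (mono-⊛-mono-swap {S} {suc a} {3 + a} {k + k} (closed (suc a + gap (suc a)) k) exponents n)) ⟩
    mono S ⊛ closed (suc (suc a)) (suc k) ⊕ mono (3 + a) ⊛ (mono (k + k) ⊛ closed (suc a + gap (suc a)) k)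
      ≡⟨ cong (λ g → mono S ⊛ closed (suc (suc a)) (suc k) ⊕ mono (3 + a) ⊛ (mono (k + k) ⊛ closed (suc (a + g)) k))
              (gap-+2 (suc a)) ⟨
    mono S ⊛ closed (suc (suc a)) (suc k) ⊕ mono (3 + a) ⊛ closed (3 + a + gap (3 + a)) k ∎
    where
    open ≗-Reasoning
    S = suc k + suc k
    exponents : S + suc a ≡ 3 + a + (k + k)
    exponents = solve 2 (λ k a → (con 1 :+ k) :+ (con 1 :+ k) :+ (con 1 :+ a) := con 3 :+ a :+ (k :+ k)) refl k a
      where open +-*-Solver


-- On a cond11 partition of n the number of 1-hooks is the number of parts, which is at most n.
hooks-by-length : ∀ {n} p → Partition≤ n p → sum p ≡ n →
  when (cond11 p) (numHooks 1 p) ≡ Σ< (suc n) (λ k → k * (gapWeight k ↾≥ 1) p)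
hooks-by-length {n} p π Σp rewrite all≥ᵇ-1 π with cond11 p in c
... | false = sym (Σ<-zero (suc n) (λ k _ → *-zeroʳ k))
... | true  = trans (numHooks-cond11 π (subst T (sym c) tt))
                    (sym (Σ<-indicator (suc n) (length p) (s≤s (subst (length p ≤_) Σp (length≤sum π)))))

g21≡rhs21 : ∀ n → g21 n ≡ rhs21 n
g21≡rhs21 n = begin
  g21 n                                              ≡⟨ sum-map-filter cond21 (numHooks 1) (partitions n) ⟩
  Σ⊢ (λ p → when (cond21 p) (numHooks 1 p)) n        ≡⟨ ΣP-cong n (λ p → cong (λ b → when b (numHooks 1 p)) (cond21≡allIn p)) n ⟩
  ΣP n hooksIn n                                     ≡⟨ ΣP-hooksIn n n ⟩
  (prodIn n ⊛ sumIn n) n                             ≡⟨ ⊛-cong≤ (λ i → invProd1568-coeff) sumIn≈ n ≤-refl ⟩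
  (invProd1568 ⊛ (residues156 ⊛ geom 8)) n           ∎
  where
  open ≡-Reasoning
  sumIn≈ : Agree≤ n (sumIn n) (residues156 ⊛ geom 8)
  sumIn≈ j j≤n = trans (sumIn-coeff refl n j≤n) (trans (sym (geom8-⊛-residues156 j)) (⊛-comm (geom 8) residues156 j))

g11≡rhs11 : ∀ n → g11 n ≡ rhs11 n
g11≡rhs11 n = begin
  g11 n
    ≡⟨ sum-map-filter cond11 (numHooks 1) (partitions n) ⟩
  Σ⊢ (λ p → when (cond11 p) (numHooks 1 p)) n
    ≡⟨ ΣP-congᴾ n n hooks-by-length ⟩
  Σ⊢ (λ p → Σ< (suc n) (λ k → k * (gapWeight k ↾≥ 1) p)) n
    ≡⟨ ΣP-Σ< n (suc n) (λ k p → k * (gapWeight k ↾≥ 1) p) n ⟩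
  Σ< (suc n) (λ k → ΣP n (λ p → k * (gapWeight k ↾≥ 1) p) n)
    ≡⟨ Σ<-cong (suc n) (λ k _ → ΣP-*ˡ n k (gapWeight k ↾≥ 1) n) ⟩
  Σ< (suc n) (λ k → k * gapCount 1 k n)
    ≡⟨ Σ<-cong (suc n) (λ k _ → cong (k *_) (gapRecursion-unique gapCount-recursion closed-recursion 0 k n)) ⟩
  Σ< (suc n) (λ k → term11 k n)
    ≡⟨ cong sum (map-upTo (λ k → term11 k n) (suc n)) ⟨
  rhs11 n ∎
  where open ≡-Reasoning

proposition5p1 : (∀ (n : ℕ) → g11 n ≡ rhs11 n) × (∀ (n : ℕ) → g21 n ≡ rhs21 n)
proposition5p1 = g11≡rhs11 , g21≡rhs21
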